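{- For $n\geq 3$, the set $C_n^{(1)}$ of permutations $\sigma\in S_n$ with exactly one preimage under $\mathrm{psb}$ equals $$\{\pi=\pi_1\cdots\pi_n\in S_n : \pi_n=n,\ \text{there exists } k\ge 0 \text{ with } LTR(\pi)=\{n-k,\dots,n\},\ \text{and for all } \pi_i,\pi_j\in LTR(\pi) \text{ with } \pi_i\neq\pi_j \text{ we have } |j-i|>1\}.$$ Moreover $|C_n^{(1)}|=\sum_{k=2}^{\lceil n/2\rceil}(n-k)!\binom{n-k-1}{k-2}$.
   Context: For a permutation $\pi=\pi_1\cdots\pi_n$, an entry $\pi_i$ is a left-to-right maximum if $\pi_i=\max\{\pi_j: j\le i\}$; $LTR(\pi)$ denotes the set of left-to-right maxima. The algorithm PSB processes $\pi$ from left to right with one pop stack $S$ (initially empty; PUSH puts an element on top, POP removes all elements appending them to the output from top to bottom) and an initially empty output: for $i=1,\dots,n$, if $S$ is empty or $\pi_i=\mathrm{TOP}(S)-1$ (where $\mathrm{TOP}(S)$ is the top element of $S$), push $\pi_i$; else if $\pi_i<\mathrm{TOP}(S)-1$, append $\pi_i$ directly to the output (bypass); otherwise pop $S$ and then push $\pi_i$. After all entries are processed, pop $S$. This defines a map $\mathrm{psb}:S_n\to S_n$; a preimage of $\sigma$ is any $\pi\in S_n$ with $\mathrm{psb}(\pi)=\sigma$. -}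

module Defs where

open import Data.Nat using (ℕ; zero; suc; _+_; _*_; _∸_; _≤_; _<_; _≟_; _<?_; ⌈_/2⌉; ∣_-_∣; _!)
open import Data.Nat.Combinatorics using (_C_)
open import Data.List using (List; []; _∷_; _++_; map; upTo; applyUpTo; length; lookup; _∷ʳ_)
open import Data.Nat.ListAction using (sum)
open import Data.List.Relation.Binary.Permutation.Propositional using (_↭_)
open import Data.Fin using (Fin; toℕ)
open import Data.Product using (Σ; _×_; ∃; ∃-syntax)
open import Relation.Nullary using (¬_; yes; no)
open import Relation.Binary.PropositionalEquality using (_≡_; _≢_)
open import Function.Bundles using (_⇔_)

oneTo : ℕ → List ℕ
oneTo n = map suc (upTo n)

-- π ∈ S_n : π is a rearrangement of 1,…,n (one-line notation, as a list)
IsPerm : ℕ → List ℕ → Set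
IsPerm n π = π ↭ (oneTo n)

-- PSB with a pop stack.  The stack is a list whose head is TOP(S).
-- psbGo S input = output produced from now on.
psbGo : List ℕ → List ℕ → List ℕ
psbGo s [] = s
psbGo [] (x ∷ xs) = psbGo (x ∷ []) xs
psbGo (t ∷ s) (x ∷ xs) with suc x ≟ t
... | yes _ = psbGo (x ∷ t ∷ s) xs
... | no _ with suc x <? t
...   | yes _ = x ∷ psbGo (t ∷ s) xs
...   | no _ = (t ∷ s) ++ psbGo (x ∷ []) xs

psb : List ℕ → List ℕ
psb π = psbGo [] π

HasUniquePreimage : ℕ → List ℕ → Set
HasUniquePreimage n σ =
  IsPerm n σ ×
  (∃[ π ] (IsPerm n π × psb π ≡ σ ×
     (∀ π′ → IsPerm n π′ → psb π′ ≡ σ → π′ ≡ π)))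

IsLTRPos : (π : List ℕ) → Fin (length π) → Set
IsLTRPos π i = ∀ (j : Fin (length π)) → toℕ j ≤ toℕ i → lookup π j ≤ lookup π i

_∈LTR_ : ℕ → List ℕ → Set
v ∈LTR π = ∃[ i ] (lookup π i ≡ v × IsLTRPos π i)

-- the condition describing C_n^(1) (besides π ∈ S_n)
C1Condition : ℕ → List ℕ → Set
C1Condition n π =
  (∃[ ρ ] π ≡ ρ ∷ʳ n) ×
  (∃[ k ] (∀ v → (v ∈LTR π) ⇔ (n ∸ k ≤ v × v ≤ n))) ×
  (∀ (i j : Fin (length π)) → IsLTRPos π i → IsLTRPos π j →
     lookup π i ≢ lookup π j → 1 < ∣ toℕ j - toℕ i ∣)

countFormula : ℕ → ℕ
countFormula n =
  sum (map (λ k → ((n ∸ k) !) * ((n ∸ k ∸ 1) C (k ∸ 2)))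
           (applyUpTo (λ i → i + 2) (⌈ n /2⌉ ∸ 1)))

module Submission where

-- PSB treats π run by run: a left-to-right maximum M meets a popped (or empty) stack and
-- is pushed, and each later entry up to the next left-to-right maximum is pushed if it is
-- one less than the top and bypassed otherwise.  So psb π is the concatenation of the
-- outputs of the runs.
--
-- If σ = M a₁ (M+1) a₂ … aₖ (M+k) with nonempty blocks aᵢ of entries below M, the output
-- of each run of a preimage must end exactly at the next M+i, which forces the preimage
-- M (M+1) a₁ (M+2) a₂ … (M+k) aₖ.  Conversely the runs of a unique preimage are rigid:
-- the first run has no body (its first entry could form a run of its own), the run of a
-- head P is followed by the run of P+1 (it could otherwise be absorbed, bypassed, into
-- the next run), and that run has a body (P could otherwise be pushed under P+1).  This
-- is the shape above, whose left-to-right maxima M, …, n are pairwise non-adjacent: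
-- C1Condition.  With K = k + 1 left-to-right maxima there are (n-K)! choices for the
-- entries below M and C(n-K-1, K-2) ways to cut them into k nonempty blocks, and
-- 2K - 1 ≤ n.

open import Defs
open import Data.Nat
open import Data.Nat.Properties
open import Data.Nat.Combinatorics using (_C_; nCk+nC[k+1]≡[n+1]C[k+1])
open import Data.Nat.ListAction using (sum)
open import Data.List using (List; []; _∷_; _++_; _∷ʳ_; map; length; concat; concatMap; applyUpTo; upTo; lookup)
open import Data.List.Properties
  using (++-assoc; ++-identityʳ; ++-cancelˡ; ∷-injective; ∷-injectiveˡ; ∷-injectiveʳ;
         ∷ʳ-injectiveˡ; ∷ʳ-injectiveʳ; length-++; length-map; length-applyUpTo;
         map-++; applyUpTo-∷ʳ; map-cong-local)
open import Data.List.Relation.Unary.All as All using (All; []; _∷_)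
import Data.List.Relation.Unary.All.Properties as All
open import Data.List.Relation.Unary.Any as Any using (Any; here; there)
open import Data.List.Membership.Propositional using (_∈_; _∉_; find)
open import Data.List.Membership.Propositional.Properties
  using (∈-++⁺ˡ; ∈-++⁺ʳ; ∈-++⁻; ∈-∃++; ∈-map⁺; ∈-map⁻; ∈-upTo⁺; ∈-upTo⁻;
         ∈-concatMap⁺; ∈-concatMap⁻; ∈-applyUpTo⁺; ∈-applyUpTo⁻; ∈-lookup)
open import Data.List.Relation.Unary.Unique.Propositional using (Unique; []; _∷_)
import Data.List.Relation.Unary.Unique.Propositional.Properties as Unique
open import Data.List.Relation.Unary.Unique.Propositional.Properties using (Unique[x∷xs]⇒x∉xs)
open import Data.List.Relation.Binary.Permutation.Propositional
  using (_↭_; prep; swap; ↭-refl; ↭-sym; ↭-trans; ↭-reflexive; ↭⇒↭ₛ)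
open import Data.List.Relation.Binary.Permutation.Propositional.Properties
  using (∈-resp-↭; All-resp-↭; shift; ++⁺ʳ; ++⁺ˡ; ↭-empty-inv; ↭-length; drop-mid; drop-∷; ∷↭∷ʳ)
import Data.List.Relation.Binary.Permutation.Setoid.Properties as Permutationₛ
open import Data.Product hiding (swap; map)
open import Data.Sum hiding (swap; map)
open import Data.Unit using (⊤; tt)
open import Data.Empty using (⊥; ⊥-elim)
open import Data.Fin as F using (Fin; toℕ)
import Data.Fin.Properties as F
open import Function.Base using (id; _∘_)
open import Function.Bundles using (_⇔_; mk⇔; Equivalence)
open import Function.Properties.Equivalence using () renaming (trans to ⇔-trans; sym to ⇔-sym)
open import Relation.Nullary
open import Relation.Binary.Definitions using (tri<; tri≈; tri>)
open import Relation.Binary.PropositionalEquality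
open ≡-Reasoning

private
  variable
    A B : Set

++-≡-++-split : ∀ (xs ys us vs : List A) → xs ++ ys ≡ us ++ vs →
  ∃ λ m → (xs ≡ us ++ m × vs ≡ m ++ ys) ⊎ (us ≡ xs ++ m × ys ≡ m ++ vs)
++-≡-++-split [] ys us vs eq = us , inj₂ (refl , eq)
++-≡-++-split (x ∷ xs) ys [] vs eq = x ∷ xs , inj₁ (refl , sym eq)
++-≡-++-split (x ∷ xs) ys (u ∷ us) vs eq with ∷-injective eq
... | refl , eq′ with ++-≡-++-split xs ys us vs eq′
... | m , inj₁ (a , b) = m , inj₁ (cong (x ∷_) a , b)
... | m , inj₂ (a , b) = m , inj₂ (cong (x ∷_) a , b)

∈-∷ʳ : ∀ (u : List A) x → x ∈ u ∷ʳ x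
∈-∷ʳ [] x = here refl
∈-∷ʳ (y ∷ u) x = there (∈-∷ʳ u x)

∈-∷ʳ⁻ : ∀ {y : A} a Q → y ∈ a ∷ʳ Q → y ≢ Q → y ∈ a
∈-∷ʳ⁻ a Q m ne with ∈-++⁻ a m
... | inj₁ p = p
... | inj₂ (here e) = ⊥-elim (ne e)

∷ʳ≢[] : ∀ (u : List A) x → u ∷ʳ x ≢ []
∷ʳ≢[] [] x ()
∷ʳ≢[] (_ ∷ _) x ()

++-∷≢[] : ∀ (a : List A) Q r → a ++ Q ∷ r ≢ []
++-∷≢[] [] Q r ()
++-∷≢[] (_ ∷ _) Q r ()

NonEmpty : List A → Set
NonEmpty [] = ⊥
NonEmpty (_ ∷ _) = ⊤

NonEmpty⇒∷ʳ : ∀ (a : List A) → NonEmpty a → ∃₂ λ a₀ y → a ≡ a₀ ∷ʳ y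
NonEmpty⇒∷ʳ (x ∷ []) _ = [] , x , refl
NonEmpty⇒∷ʳ (x ∷ y ∷ a) _ with NonEmpty⇒∷ʳ (y ∷ a) tt
... | a₀ , z , eq = x ∷ a₀ , z , cong (x ∷_) eq

++-≡-∷ʳ-suffix : ∀ (ys zs u : List A) x → ys ++ zs ≡ u ∷ʳ x → NonEmpty zs → ∃ λ z₀ → zs ≡ z₀ ∷ʳ x
++-≡-∷ʳ-suffix ys zs u x eq ne with NonEmpty⇒∷ʳ zs ne
... | z₀ , z , refl = z₀ , cong (z₀ ∷ʳ_) (∷ʳ-injectiveʳ (ys ++ z₀) u (trans (++-assoc ys z₀ _) eq))

Unique-tail : ∀ {x : A} {xs} → Unique (x ∷ xs) → Unique xs
Unique-tail (_ ∷ u) = u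

Unique-++⁻ˡ : ∀ (xs : List A) {ys} → Unique (xs ++ ys) → Unique xs
Unique-++⁻ˡ [] u = []
Unique-++⁻ˡ (x ∷ xs) (px ∷ u) = All.++⁻ˡ xs px ∷ Unique-++⁻ˡ xs u

Unique-++⁻ʳ : ∀ (xs : List A) {ys} → Unique (xs ++ ys) → Unique ys
Unique-++⁻ʳ [] u = u
Unique-++⁻ʳ (x ∷ xs) (_ ∷ u) = Unique-++⁻ʳ xs u

Unique-++-disjoint : ∀ (xs : List A) {ys} {v} → Unique (xs ++ ys) → v ∈ xs → v ∈ ys → ⊥
Unique-++-disjoint (x ∷ xs) (px ∷ u) (here refl) vy = All.lookup (All.++⁻ʳ xs px) vy refl
Unique-++-disjoint (x ∷ xs) (px ∷ u) (there vx) vy = Unique-++-disjoint xs u vx vy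

Unique-resp-↭ : ∀ {xs ys : List A} → xs ↭ ys → Unique xs → Unique ys
Unique-resp-↭ p = Permutationₛ.Unique-resp-↭ (setoid _) (↭⇒↭ₛ p)

Unique-map : ∀ (f : A → B) (xs : List A) → Unique xs →
  (∀ a b → a ∈ xs → b ∈ xs → f a ≡ f b → a ≡ b) → Unique (map f xs)
Unique-map f [] _ _ = []
Unique-map f (x ∷ xs) (px ∷ u) inj =
  All.tabulate (λ t∈ e → let (y , y∈ , t≡) = ∈-map⁻ f t∈ in All.lookup px y∈ (inj x y (here refl) (there y∈) (trans e t≡)))
  ∷ Unique-map f xs u (λ a b ma mb → inj a b (there ma) (there mb))

∈-concatMap⁻′ : ∀ (f : A → List B) xs {y} → y ∈ concatMap f xs → ∃ λ x → x ∈ xs × y ∈ f x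
∈-concatMap⁻′ f xs m = find (∈-concatMap⁻ f {xs = xs} m)

∈-concatMap⁺′ : ∀ (f : A → List B) {xs x y} → x ∈ xs → y ∈ f x → y ∈ concatMap f xs
∈-concatMap⁺′ f xm ym = ∈-concatMap⁺ f (Any.map (λ { refl → ym }) xm)

Unique-concatMap : ∀ (f : A → List B) (xs : List A) →
  Unique xs → (∀ x → x ∈ xs → Unique (f x)) →
  (∀ x y t → x ∈ xs → y ∈ xs → t ∈ f x → t ∈ f y → x ≡ y) → Unique (concatMap f xs)
Unique-concatMap f [] _ _ _ = []
Unique-concatMap f (x ∷ xs) (px ∷ u) uf disj =
  Unique.++⁺ (uf x (here refl)) (Unique-concatMap f xs u (λ y m → uf y (there m)) (λ a b t ma mb → disj a b t (there ma) (there mb)))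
    (λ (t∈fx , t∈rest) → let (y , y∈ , t∈fy) = ∈-concatMap⁻′ f xs t∈rest
                         in All.lookup px y∈ (disj x y _ (here refl) (there y∈) t∈fx t∈fy))

length-concatMap : ∀ (f : A → List B) (xs : List A) → length (concatMap f xs) ≡ sum (map (λ x → length (f x)) xs)
length-concatMap f [] = refl
length-concatMap f (x ∷ xs) = trans (length-++ (f x)) (cong (length (f x) +_) (length-concatMap f xs))

length-concatMap-const : ∀ (f : A → List B) (xs : List A) c →
  (∀ x → x ∈ xs → length (f x) ≡ c) → length (concatMap f xs) ≡ length xs * c
length-concatMap-const f [] c _ = refl
length-concatMap-const f (x ∷ xs) c h =
  trans (length-++ (f x)) (cong₂ _+_ (h x (here refl)) (length-concatMap-const f xs c (λ y m → h y (there m))))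

↭-++-cancelʳ : ∀ (R xs ys : List A) → xs ++ R ↭ ys ++ R → xs ↭ ys
↭-++-cancelʳ [] xs ys p = ↭-trans (↭-sym (↭-reflexive (++-identityʳ xs))) (↭-trans p (↭-reflexive (++-identityʳ ys)))
↭-++-cancelʳ (r ∷ R) xs ys p = ↭-++-cancelʳ R xs ys (drop-mid xs ys p)

↭-exchange : ∀ (x y : A) ws r → y ∷ ws ++ x ∷ r ↭ x ∷ ws ++ y ∷ r
↭-exchange x y ws r = ↭-trans (prep y (shift x ws r)) (↭-trans (swap y x ↭-refl) (prep x (↭-sym (shift y ws r))))

∈-oneTo⁻ : ∀ {n x} → x ∈ oneTo n → 1 ≤ x × x ≤ n
∈-oneTo⁻ m with ∈-map⁻ suc m
... | i , i∈ , refl = s≤s z≤n , ∈-upTo⁻ i∈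

∈-oneTo⁺ : ∀ {n x} → 1 ≤ x → x ≤ n → x ∈ oneTo n
∈-oneTo⁺ {x = suc i} _ le = ∈-map⁺ suc (∈-upTo⁺ le)

length-oneTo : ∀ m → length (oneTo m) ≡ m
length-oneTo m = trans (length-map suc (upTo m)) (length-applyUpTo _ m)

oneTo-unique : ∀ n → Unique (oneTo n)
oneTo-unique n = Unique.map⁺ suc-injective (Unique.upTo⁺ n)

oneTo-∷ʳ : ∀ m → oneTo (suc m) ≡ oneTo m ∷ʳ suc m
oneTo-∷ʳ m = begin
  map suc (upTo (suc m))  ≡⟨ cong (map suc) (sym (applyUpTo-∷ʳ id m)) ⟩
  map suc (upTo m ∷ʳ m)   ≡⟨ map-++ suc (upTo m) (m ∷ []) ⟩
  oneTo m ∷ʳ suc m        ∎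

IsPerm⇒Unique : ∀ {n σ} → IsPerm n σ → Unique σ
IsPerm⇒Unique {n} p = Unique-resp-↭ (↭-sym p) (oneTo-unique n)

IsPerm-∈⁻ : ∀ {n σ x} → IsPerm n σ → x ∈ σ → 1 ≤ x × x ≤ n
IsPerm-∈⁻ p m = ∈-oneTo⁻ (∈-resp-↭ p m)

IsPerm-∈⁺ : ∀ {n σ x} → IsPerm n σ → 1 ≤ x → x ≤ n → x ∈ σ
IsPerm-∈⁺ p a b = ∈-resp-↭ (↭-sym p) (∈-oneTo⁺ a b)

-- Runs of PSB

-- runOutput t v is what PSB outputs from the moment t is pushed onto an empty stack,
-- when the entries v are then processed without popping, followed by a final pop.
runOutput : ℕ → List ℕ → List ℕ
runOutput t [] = t ∷ []
runOutput t (x ∷ xs) with suc x ≟ t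
... | yes _ = runOutput x xs ∷ʳ t
... | no _ = x ∷ runOutput t xs

PopFree : ℕ → List ℕ → Set
PopFree t [] = ⊤
PopFree t (x ∷ xs) = (suc x ≡ t × PopFree x xs) ⊎ (suc x < t × PopFree t xs)

EndsRun : ℕ → List ℕ → Set
EndsRun t [] = ⊤
EndsRun t (y ∷ ys) = t ≤ y

EndsRun-≤ : ∀ {s t} rest → s ≤ t → EndsRun t rest → EndsRun s rest
EndsRun-≤ [] _ _ = tt
EndsRun-≤ (_ ∷ _) s≤t t≤y = ≤-trans s≤t t≤y

psbGo-run : ∀ t s v rest → PopFree t v → EndsRun t rest →
  psbGo (t ∷ s) (v ++ rest) ≡ runOutput t v ++ s ++ psb rest
psbGo-run t s [] [] _ _ = cong (t ∷_) (sym (++-identityʳ s))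
psbGo-run t s [] (y ∷ ys) _ t≤y with suc y ≟ t
... | yes eq = ⊥-elim (<-irrefl (sym eq) (s≤s t≤y))
... | no _ with suc y <? t
...   | yes lt = ⊥-elim (<⇒≱ lt (m≤n⇒m≤1+n t≤y))
...   | no _ = refl
psbGo-run t s (x ∷ xs) rest (inj₁ (eq , np)) ends with suc x ≟ t
... | no neq = ⊥-elim (neq eq)
... | yes _ = begin
    psbGo (x ∷ t ∷ s) (xs ++ rest)
      ≡⟨ psbGo-run x (t ∷ s) xs rest np (EndsRun-≤ rest (≤-trans (n≤1+n x) (≤-reflexive eq)) ends) ⟩
    runOutput x xs ++ t ∷ s ++ psb rest
      ≡⟨ sym (++-assoc (runOutput x xs) (t ∷ []) (s ++ psb rest)) ⟩
    (runOutput x xs ∷ʳ t) ++ s ++ psb rest ∎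
psbGo-run t s (x ∷ xs) rest (inj₂ (lt , np)) ends with suc x ≟ t
... | yes eq = ⊥-elim (<-irrefl eq lt)
... | no _ with suc x <? t
...   | no nlt = ⊥-elim (nlt lt)
...   | yes _ = cong (x ∷_) (psbGo-run t s xs rest np ends)

runOutput-↭ : ∀ t v → runOutput t v ↭ t ∷ v
runOutput-↭ t [] = ↭-refl
runOutput-↭ t (x ∷ xs) with suc x ≟ t
... | yes _ = ↭-trans (++⁺ʳ (t ∷ []) (runOutput-↭ x xs)) (↭-sym (∷↭∷ʳ t (x ∷ xs)))
... | no _ = ↭-trans (prep x (runOutput-↭ t xs)) (swap x t ↭-refl)

runOutput-≤-head : ∀ x w → All (_< x) w → All (_≤ x) (runOutput x w)
runOutput-≤-head x w w<x = All-resp-↭ (↭-sym (runOutput-↭ x w)) (≤-refl ∷ All.map <⇒≤ w<x)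

runOutput-∷ʳ-head : ∀ t v → ∃ λ u → runOutput t v ≡ u ∷ʳ t
runOutput-∷ʳ-head t [] = [] , refl
runOutput-∷ʳ-head t (x ∷ xs) with suc x ≟ t
... | yes _ = runOutput x xs , refl
... | no _ with runOutput-∷ʳ-head t xs
...   | u , eq = x ∷ u , cong (x ∷_) eq

runOutput-∷ʳ-pred : ∀ p v → p ∈ v → ∃ λ u → runOutput (suc p) v ≡ u ++ p ∷ suc p ∷ []
runOutput-∷ʳ-pred p (x ∷ xs) m with suc x ≟ suc p
... | yes eq with runOutput-∷ʳ-head x xs
...   | u , e = u , (begin
        runOutput x xs ∷ʳ suc p        ≡⟨ cong (_∷ʳ suc p) e ⟩
        (u ∷ʳ x) ∷ʳ suc p              ≡⟨ ++-assoc u (x ∷ []) (suc p ∷ []) ⟩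
        u ++ x ∷ suc p ∷ []            ≡⟨ cong (λ z → u ++ z ∷ suc p ∷ []) (suc-injective eq) ⟩
        u ++ p ∷ suc p ∷ []            ∎)
runOutput-∷ʳ-pred p (x ∷ xs) (here refl) | no neq = ⊥-elim (neq refl)
runOutput-∷ʳ-pred p (x ∷ xs) (there m) | no neq with runOutput-∷ʳ-pred p xs m
... | u , e = x ∷ u , cong (x ∷_) e

runOutput-pred : ∀ p → runOutput (suc p) (p ∷ []) ≡ p ∷ suc p ∷ []
runOutput-pred p with suc p ≟ suc p
... | yes _ = refl
... | no ne = ⊥-elim (ne refl)

runOutput-bypassing : ∀ t v → All (λ x → suc x ≢ t) v → runOutput t v ≡ v ∷ʳ t
runOutput-bypassing t [] _ = refl
runOutput-bypassing t (x ∷ xs) (px ∷ ps) with suc x ≟ t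
... | yes eq = ⊥-elim (px eq)
... | no _ = cong (x ∷_) (runOutput-bypassing t xs ps)

runOutput-++-bypassing : ∀ t u r → All (λ x → suc x ≢ t) u → runOutput t (u ++ r) ≡ u ++ runOutput t r
runOutput-++-bypassing t [] r _ = refl
runOutput-++-bypassing t (x ∷ xs) r (px ∷ ps) with suc x ≟ t
... | yes eq = ⊥-elim (px eq)
... | no _ = cong (x ∷_) (runOutput-++-bypassing t xs r ps)

PopFree-++-bypassing : ∀ t u r → All (λ x → suc x < t) u → PopFree t r → PopFree t (u ++ r)
PopFree-++-bypassing t [] r _ np = np
PopFree-++-bypassing t (x ∷ xs) r (px ∷ ps) np = inj₂ (px , PopFree-++-bypassing t xs r ps np)

PopFree-bypassing : ∀ t u → All (λ x → suc x < t) u → PopFree t u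
PopFree-bypassing t [] _ = tt
PopFree-bypassing t (x ∷ xs) (p ∷ ps) = inj₂ (p , PopFree-bypassing t xs ps)

PopFree-below : ∀ t v → Unique v → All (_< t) v → PopFree t v
PopFree-below t [] _ _ = tt
PopFree-below t (x ∷ xs) (x∉ ∷ u) (x<t ∷ xs<t) with suc x ≟ t
... | yes eq = inj₁ (eq , PopFree-below x xs u (All.zipWith below-x (x∉ , xs<t)))
  where
  below-x : ∀ {y} → x ≢ y × y < t → y < x
  below-x (x≢y , y<t) = ≤∧≢⇒< (≤-pred (≤-trans y<t (≤-reflexive (sym eq)))) (x≢y ∘ sym)
... | no ne = inj₂ (≤∧≢⇒< x<t ne , PopFree-below t xs u xs<t)

below⇒bypass : ∀ L Q (a : List ℕ) → L < Q → All (_< L) a → All (λ x → suc x < Q) a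
below⇒bypass L Q a L<Q = All.map (λ z → <-≤-trans (s≤s z) L<Q)

below⇒noPush : ∀ L Q (a : List ℕ) → L < Q → All (_< L) a → All (λ x → suc x ≢ Q) a
below⇒noPush L Q a L<Q a<L = All.map (λ z e → <-irrefl e z) (below⇒bypass L Q a L<Q a<L)

psbGo-↭ : ∀ s l → psbGo s l ↭ s ++ l
psbGo-↭ s [] = ↭-sym (↭-reflexive (++-identityʳ s))
psbGo-↭ [] (x ∷ xs) = psbGo-↭ (x ∷ []) xs
psbGo-↭ (t ∷ s) (x ∷ xs) with suc x ≟ t
... | yes _ = ↭-trans (psbGo-↭ (x ∷ t ∷ s) xs) (↭-sym (shift x (t ∷ s) xs))
... | no _ with suc x <? t
...   | yes _ = ↭-trans (prep x (psbGo-↭ (t ∷ s) xs)) (↭-sym (shift x (t ∷ s) xs))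
...   | no _ = ++⁺ˡ (t ∷ s) (psbGo-↭ (x ∷ []) xs)

psb-↭ : ∀ l → psb l ↭ l
psb-↭ l = psbGo-↭ [] l

psb≡[]⇒≡[] : ∀ r → psb r ≡ [] → r ≡ []
psb≡[]⇒≡[] r eq = ↭-empty-inv (↭-trans (↭-sym (psb-↭ r)) (↭-reflexive eq))

-- Decomposition into runs

Run : Set
Run = ℕ × List ℕ

runsInput : List Run → List ℕ
runsInput [] = []
runsInput ((M , w) ∷ rs) = M ∷ w ++ runsInput rs

runsOutput : List Run → List ℕ
runsOutput [] = []
runsOutput ((M , w) ∷ rs) = runOutput M w ++ runsOutput rs

ValidRuns : ℕ → List Run → Set
ValidRuns b [] = ⊤
ValidRuns b ((M , w) ∷ rs) = b ≤ M × PopFree M w × ValidRuns M rs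

ValidRuns-endsRun : ∀ M rs → ValidRuns M rs → EndsRun M (runsInput rs)
ValidRuns-endsRun M [] _ = tt
ValidRuns-endsRun M ((_ , _) ∷ rs) (M≤M′ , _) = M≤M′

psb-runsInput : ∀ b rs → ValidRuns b rs → psb (runsInput rs) ≡ runsOutput rs
psb-runsInput b [] _ = refl
psb-runsInput b ((M , w) ∷ rs) (_ , popFree , valid) = begin
  psbGo (M ∷ []) (w ++ runsInput rs)   ≡⟨ psbGo-run M [] w (runsInput rs) popFree (ValidRuns-endsRun M rs valid) ⟩
  runOutput M w ++ psb (runsInput rs)  ≡⟨ cong (runOutput M w ++_) (psb-runsInput M rs valid) ⟩
  runOutput M w ++ runsOutput rs       ∎

runsInput-++ : ∀ rs rs′ → runsInput (rs ++ rs′) ≡ runsInput rs ++ runsInput rs′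
runsInput-++ [] rs′ = refl
runsInput-++ ((M , w) ∷ rs) rs′ =
  cong (M ∷_) (trans (cong (w ++_) (runsInput-++ rs rs′)) (sym (++-assoc w (runsInput rs) (runsInput rs′))))

runsOutput-++ : ∀ rs rs′ → runsOutput (rs ++ rs′) ≡ runsOutput rs ++ runsOutput rs′
runsOutput-++ [] rs′ = refl
runsOutput-++ ((M , w) ∷ rs) rs′ =
  trans (cong (runOutput M w ++_) (runsOutput-++ rs rs′)) (sym (++-assoc (runOutput M w) (runsOutput rs) (runsOutput rs′)))

lastHead : ℕ → List Run → ℕ
lastHead b [] = b
lastHead b ((M , _) ∷ rs) = lastHead M rs

ValidRuns-replaceSuffix : ∀ b pre rest rest′ → ValidRuns b (pre ++ rest) →
  (ValidRuns (lastHead b pre) rest → ValidRuns (lastHead b pre) rest′) → ValidRuns b (pre ++ rest′)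
ValidRuns-replaceSuffix b [] rest rest′ valid replace = replace valid
ValidRuns-replaceSuffix b ((M , w) ∷ pre) rest rest′ (b≤M , popFree , valid) replace =
  b≤M , popFree , ValidRuns-replaceSuffix M pre rest rest′ valid replace

-- The run heads are the left-to-right maxima.
StrictRuns : ℕ → List Run → Set
StrictRuns b [] = ⊤
StrictRuns b ((M , w) ∷ rs) = b ≤ M × All (_< M) w × StrictRuns (suc M) rs

StrictRuns-endsRun : ∀ b rs → StrictRuns b rs → EndsRun b (runsInput rs)
StrictRuns-endsRun b [] _ = tt
StrictRuns-endsRun b ((_ , _) ∷ rs) (b≤M , _) = b≤M

StrictRuns⇒ValidRuns : ∀ b b′ rs → b ≤ b′ → StrictRuns b′ rs → Unique (runsInput rs) → ValidRuns b rs
StrictRuns⇒ValidRuns b b′ [] _ _ _ = tt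
StrictRuns⇒ValidRuns b b′ ((M , w) ∷ rs) b≤b′ (b′≤M , w<M , strict) (_ ∷ u) =
  ≤-trans b≤b′ b′≤M , PopFree-below M w (Unique-++⁻ˡ w u) w<M ,
  StrictRuns⇒ValidRuns M (suc M) rs (n≤1+n M) strict (Unique-++⁻ʳ w u)

splitRun : ℕ → List Run → List ℕ × List Run
splitRun x [] = [] , []
splitRun x ((M , w) ∷ rs) with M <? x
... | yes _ = (M ∷ w ++ proj₁ (splitRun x rs)) , proj₂ (splitRun x rs)
... | no _ = [] , (M , w) ∷ rs

runsOf : List ℕ → List Run
runsOf [] = []
runsOf (x ∷ xs) = (x , proj₁ (splitRun x (runsOf xs))) ∷ proj₂ (splitRun x (runsOf xs))

splitRun-input : ∀ x rs → proj₁ (splitRun x rs) ++ runsInput (proj₂ (splitRun x rs)) ≡ runsInput rs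
splitRun-input x [] = refl
splitRun-input x ((M , w) ∷ rs) with M <? x
... | yes _ = cong (M ∷_) (trans (++-assoc w (proj₁ (splitRun x rs)) _) (cong (w ++_) (splitRun-input x rs)))
... | no _ = refl

runsInput-runsOf : ∀ l → runsInput (runsOf l) ≡ l
runsInput-runsOf [] = refl
runsInput-runsOf (x ∷ xs) = cong (x ∷_) (trans (splitRun-input x (runsOf xs)) (runsInput-runsOf xs))

splitRun-strict : ∀ x b rs → StrictRuns b rs → x ∉ runsInput rs →
  All (_< x) (proj₁ (splitRun x rs)) × StrictRuns (suc x) (proj₂ (splitRun x rs))
splitRun-strict x b [] _ _ = [] , tt
splitRun-strict x b ((M , w) ∷ rs) (_ , w<M , strict) x∉ with M <? x
... | yes M<x with splitRun-strict x (suc M) rs strict (λ m → x∉ (there (∈-++⁺ʳ w m)))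
...   | body<x , strict′ = (M<x ∷ All.++⁺ (All.map (λ z → <-trans z M<x) w<M) body<x) , strict′
splitRun-strict x b ((M , w) ∷ rs) (_ , w<M , strict) x∉ | no M≮x =
  [] , (≤∧≢⇒< (≮⇒≥ M≮x) (λ e → x∉ (here e)) , w<M , strict)

runsOf-strict : ∀ l → Unique l → StrictRuns 0 (runsOf l)
runsOf-strict [] _ = tt
runsOf-strict (x ∷ xs) (x∉ ∷ u) with splitRun-strict x 0 (runsOf xs) (runsOf-strict xs u)
                                       (λ m → All.lookup x∉ (subst (x ∈_) (runsInput-runsOf xs) m) refl)
... | body<x , strict = z≤n , body<x , strict

-- The shape of the permutations with a unique preimage

interleave : ℕ → List (List ℕ) → List ℕ
interleave Q [] = []
interleave Q (a ∷ ss) = a ++ Q ∷ interleave (suc Q) ss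

C1Shape : ℕ → List ℕ → Set
C1Shape n σ = IsPerm n σ × ∃₂ λ M ss → σ ≡ M ∷ interleave (suc M) ss × All NonEmpty ss × All (All (_< M)) ss

canonicalRuns : ℕ → List (List ℕ) → List Run
canonicalRuns Q [] = []
canonicalRuns Q (a ∷ ss) = (Q , a) ∷ canonicalRuns (suc Q) ss

runsOutput-canonicalRuns : ∀ L Q ss → L < Q → All (All (_< L)) ss → runsOutput (canonicalRuns Q ss) ≡ interleave Q ss
runsOutput-canonicalRuns L Q [] _ _ = refl
runsOutput-canonicalRuns L Q (a ∷ ss) L<Q (a<L ∷ als) = begin
  runOutput Q a ++ runsOutput (canonicalRuns (suc Q) ss)
    ≡⟨ cong₂ _++_ (runOutput-bypassing Q a (below⇒noPush L Q a L<Q a<L)) (runsOutput-canonicalRuns L (suc Q) ss (m<n⇒m<1+n L<Q) als) ⟩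
  (a ∷ʳ Q) ++ interleave (suc Q) ss
    ≡⟨ ++-assoc a (Q ∷ []) _ ⟩
  a ++ Q ∷ interleave (suc Q) ss ∎

canonicalRuns-valid : ∀ L b Q ss → L < Q → b ≤ Q → All (All (_< L)) ss → ValidRuns b (canonicalRuns Q ss)
canonicalRuns-valid L b Q [] _ _ _ = tt
canonicalRuns-valid L b Q (a ∷ ss) L<Q b≤Q (a<L ∷ als) =
  b≤Q , PopFree-bypassing Q a (below⇒bypass L Q a L<Q a<L) , canonicalRuns-valid L Q (suc Q) ss (m<n⇒m<1+n L<Q) (n≤1+n Q) als

runsInput-canonicalRuns-↭ : ∀ Q ss → runsInput (canonicalRuns Q ss) ↭ interleave Q ss
runsInput-canonicalRuns-↭ Q [] = ↭-refl
runsInput-canonicalRuns-↭ Q (a ∷ ss) =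
  ↭-trans (prep Q (++⁺ˡ a (runsInput-canonicalRuns-↭ (suc Q) ss))) (↭-sym (shift Q a (interleave (suc Q) ss)))

canonicalPreimage : ℕ → List (List ℕ) → List ℕ
canonicalPreimage M ss = runsInput ((M , []) ∷ canonicalRuns (suc M) ss)

psb-canonicalPreimage : ∀ M ss → All (All (_< M)) ss → psb (canonicalPreimage M ss) ≡ M ∷ interleave (suc M) ss
psb-canonicalPreimage M ss als = begin
  psb (canonicalPreimage M ss)
    ≡⟨ psb-runsInput 0 ((M , []) ∷ canonicalRuns (suc M) ss) (z≤n , tt , canonicalRuns-valid M M (suc M) ss (n<1+n M) (n≤1+n M) als) ⟩
  M ∷ runsOutput (canonicalRuns (suc M) ss)
    ≡⟨ cong (M ∷_) (runsOutput-canonicalRuns M (suc M) ss (n<1+n M) als) ⟩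
  M ∷ interleave (suc M) ss ∎

canonicalPreimage-↭ : ∀ M ss → canonicalPreimage M ss ↭ M ∷ interleave (suc M) ss
canonicalPreimage-↭ M ss = prep M (runsInput-canonicalRuns-↭ (suc M) ss)

-- Uniqueness of the canonical preimage

psb-firstRun : ∀ x xs → Unique (x ∷ xs) → ∃₂ λ w r → xs ≡ w ++ r × All (_< x) w × EndsRun (suc x) r ×
  psb (x ∷ xs) ≡ runOutput x w ++ psb r
psb-firstRun x xs u with runsOf-strict (x ∷ xs) u | runsInput-runsOf (x ∷ xs)
... | _ , w<x , strict | runs≡ = w , r , xs≡ , w<x , ends , psb≡
  where
  w = proj₁ (splitRun x (runsOf xs))
  rs = proj₂ (splitRun x (runsOf xs))
  r = runsInput rs
  xs≡ : xs ≡ w ++ r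
  xs≡ = sym (∷-injectiveʳ runs≡)
  ends : EndsRun (suc x) r
  ends = StrictRuns-endsRun (suc x) rs strict
  psb≡ : psb (x ∷ xs) ≡ runOutput x w ++ psb r
  psb≡ = begin
    psbGo (x ∷ []) xs        ≡⟨ cong (psbGo (x ∷ [])) xs≡ ⟩
    psbGo (x ∷ []) (w ++ r)  ≡⟨ psbGo-run x [] w r (PopFree-below x w (Unique-++⁻ˡ w (subst Unique xs≡ (Unique-tail u))) w<x)
                                                    (EndsRun-≤ r (n≤1+n x) ends) ⟩
    runOutput x w ++ psb r   ∎

∈-runOutput-head : ∀ x w → x ∈ runOutput x w
∈-runOutput-head x w = ∈-resp-↭ (↭-sym (runOutput-↭ x w)) (here refl)

penultimate-injective : ∀ (u v : List A) {x y z z′} → u ++ x ∷ z ∷ [] ≡ v ++ y ∷ z′ ∷ [] → x ≡ y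
penultimate-injective u v e =
  ∷ʳ-injectiveʳ u v (∷ʳ-injectiveˡ (u ∷ʳ _) (v ∷ʳ _) (trans (++-assoc u _ _) (trans e (sym (++-assoc v _ _)))))

interleave-prefix : ∀ L Q ss T₁ R V → All (All (_< L)) ss → All NonEmpty ss → L ≤ Q →
  interleave Q ss ≡ T₁ ++ R → (∃ λ T₀ → T₁ ≡ T₀ ∷ʳ V) → L ≤ V →
  Q ≤ V × (∀ u → Q ≤ u → u < V → u ∈ T₁) × ∃₂ λ X y → T₁ ≡ X ++ y ∷ V ∷ [] × y < L
interleave-prefix L Q [] T₁ R V _ _ _ eq (T₀ , refl) _ = ⊥-elim (++-∷≢[] T₀ V R (trans (sym (++-assoc T₀ _ R)) (sym eq)))
interleave-prefix L Q (a ∷ ss) T₁ R V (a<L ∷ als) (ne ∷ nes) L≤Q eq (T₀ , T₁≡) L≤V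
  with ++-≡-++-split T₁ R a (Q ∷ interleave (suc Q) ss) (sym eq)
... | m , inj₂ (a≡ , _) = ⊥-elim (<⇒≱ (All.lookup a<L (subst (V ∈_) (sym a≡) (∈-++⁺ˡ (subst (V ∈_) (sym T₁≡) (∈-∷ʳ T₀ V))))) L≤V)
... | [] , inj₁ (T₁≡a , _) = ⊥-elim (<⇒≱ (All.lookup a<L (subst (V ∈_) (trans T₁≡a (++-identityʳ a)) (subst (V ∈_) (sym T₁≡) (∈-∷ʳ T₀ V)))) L≤V)
... | _ ∷ [] , inj₁ (T₁≡a∷ʳQ , e) with ∷-injective e
...   | refl , _ with NonEmpty⇒∷ʳ a ne
...     | a₀ , y , refl = ≤-reflexive (sym V≡Q) , (λ u Q≤u u<V → ⊥-elim (<⇒≱ u<V (≤-trans (≤-reflexive V≡Q) Q≤u))) ,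
            a₀ , y , T₁≡a₀yV , All.lookup a<L (∈-∷ʳ a₀ y)
  where
  V≡Q : V ≡ Q
  V≡Q = ∷ʳ-injectiveʳ T₀ (a₀ ∷ʳ y) (trans (sym T₁≡) T₁≡a∷ʳQ)
  T₁≡a₀yV : T₁ ≡ a₀ ++ y ∷ V ∷ []
  T₁≡a₀yV = trans T₁≡a∷ʳQ (trans (++-assoc a₀ (y ∷ []) (Q ∷ [])) (cong (λ z → a₀ ++ y ∷ z ∷ []) (sym V≡Q)))
interleave-prefix L Q (a ∷ ss) T₁ R V (a<L ∷ als) (ne ∷ nes) L≤Q eq (T₀ , T₁≡) L≤V | _ ∷ t ∷ T₂ , inj₁ (T₁≡aQT₂ , e)
  with ∷-injective e
...   | refl , T≡ with ++-≡-∷ʳ-suffix (a ∷ʳ Q) (t ∷ T₂) T₀ V (trans (trans (++-assoc a (Q ∷ []) (t ∷ T₂)) (sym T₁≡aQT₂)) T₁≡) tt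
...     | T₀′ , T₂≡ with interleave-prefix L (suc Q) ss (t ∷ T₂) R V als nes (m≤n⇒m≤1+n L≤Q) T≡ (T₀′ , T₂≡) L≤V
...       | Q<V , covered , X , y , T₂≡XyV , y<L = <⇒≤ Q<V , covered′ , a ++ Q ∷ X , y , T₁≡aQXyV , y<L
  where
  covered′ : ∀ u → Q ≤ u → u < V → u ∈ T₁
  covered′ u Q≤u u<V with Q ≟ u
  ... | yes refl = subst (u ∈_) (sym T₁≡aQT₂) (∈-++⁺ʳ a (here refl))
  ... | no Q≢u = subst (u ∈_) (sym T₁≡aQT₂) (∈-++⁺ʳ a (there (covered u (≤∧≢⇒< Q≤u Q≢u) u<V)))
  T₁≡aQXyV : T₁ ≡ (a ++ Q ∷ X) ++ y ∷ V ∷ []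
  T₁≡aQXyV = trans T₁≡aQT₂ (trans (cong (λ z → a ++ Q ∷ z) T₂≡XyV) (sym (++-assoc a (Q ∷ X) (y ∷ V ∷ []))))

-- A run headed by x whose output extends past the next head Q would end with x - 1, x,
-- where the shape of σ forces a small entry before x.
runOutput≢interleave-prefix : ∀ L Q ss x w a T₁ R → L ≤ Q → All (All (_< L)) ss → All NonEmpty ss → All (_< x) w →
  runOutput x w ≡ a ++ Q ∷ T₁ → NonEmpty T₁ → interleave (suc Q) ss ≡ T₁ ++ R → ⊥
runOutput≢interleave-prefix L Q ss x w a T₁ R L≤Q als nes w<x E≡ T₁≢[] T≡
  with runOutput-∷ʳ-head x w
... | u , E≡u∷ʳx with ++-≡-∷ʳ-suffix (a ∷ʳ Q) T₁ u x (trans (++-assoc a (Q ∷ []) T₁) (trans (sym E≡) E≡u∷ʳx)) T₁≢[]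
...   | T₀ , T₁≡ with interleave-prefix L (suc Q) ss T₁ R x als nes (m≤n⇒m≤1+n L≤Q) T≡ (T₀ , T₁≡) (≤-trans L≤Q Q≤x)
  where
  Q≤x : Q ≤ x
  Q≤x = All.lookup (runOutput-≤-head x w w<x) (subst (Q ∈_) (sym E≡) (∈-++⁺ʳ a (here refl)))
...     | s≤s {n = p} Q≤p , covered , X , y , T₁≡XyV , y<L = <⇒≱ y<L (≤-trans L≤Q (≤-trans Q≤p (≤-reflexive (sym y≡p))))
  where
  p∈E : p ∈ runOutput (suc p) w
  p∈E with Q ≟ p
  ... | yes refl = subst (Q ∈_) (sym E≡) (∈-++⁺ʳ a (here refl))
  ... | no Q≢p = subst (p ∈_) (sym E≡) (∈-++⁺ʳ a (there (covered p (≤∧≢⇒< Q≤p Q≢p) ≤-refl)))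
  p∈w : p ∈ w
  p∈w with ∈-resp-↭ (runOutput-↭ (suc p) w) p∈E
  ... | here p≡1+p = ⊥-elim (<-irrefl p≡1+p ≤-refl)
  ... | there p∈w = p∈w
  y≡p : y ≡ p
  y≡p with runOutput-∷ʳ-pred p w p∈w
  ... | u′ , E≡u′ = penultimate-injective (a ++ Q ∷ X) u′ (begin
    (a ++ Q ∷ X) ++ y ∷ suc p ∷ []   ≡⟨ ++-assoc a (Q ∷ X) _ ⟩
    a ++ Q ∷ X ++ y ∷ suc p ∷ []     ≡⟨ cong (λ z → a ++ Q ∷ z) T₁≡XyV ⟨
    a ++ Q ∷ T₁                      ≡⟨ E≡ ⟨
    runOutput (suc p) w              ≡⟨ E≡u′ ⟩
    u′ ++ p ∷ suc p ∷ []             ∎)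

runOutput≡∷ʳ⇒bypassed : ∀ x w a Q → All (_< x) w → All (λ y → suc y ≢ Q) a → runOutput x w ≡ a ∷ʳ Q → x ≡ Q × w ≡ a
runOutput≡∷ʳ⇒bypassed x w a Q w<x a-bypass E≡ = x≡Q , w≡a
  where
  x≡Q : x ≡ Q
  x≡Q = let (u , E≡u) = runOutput-∷ʳ-head x w in ∷ʳ-injectiveʳ u a (trans (sym E≡u) E≡)
  w-bypass : All (λ y → suc y ≢ Q) w
  w-bypass = All.tabulate λ {y} y∈w → All.lookup a-bypass
    (∈-∷ʳ⁻ a Q (subst (y ∈_) E≡ (∈-resp-↭ (↭-sym (runOutput-↭ x w)) (there y∈w)))
               (λ y≡Q → <⇒≢ (All.lookup w<x y∈w) (trans y≡Q (sym x≡Q))))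
  w≡a : w ≡ a
  w≡a = ∷ʳ-injectiveˡ w a (trans (sym (runOutput-bypassing Q w w-bypass)) (trans (cong (λ t → runOutput t w) (sym x≡Q)) E≡))

-- Either a is the (empty) block right after the maximum L = Q, or a lies below L < Q
-- while the current run starts at x ≥ L.
BlockGuard : ℕ → ℕ → List ℕ → ℕ → Set
BlockGuard L Q a x = a ≡ [] ⊎ (L < Q × L ≤ x)

BlockGuard⇒∉ : ∀ {L Q a x} → BlockGuard L Q a x → All (_< L) a → x ∉ a
BlockGuard⇒∉ (inj₁ refl) _ ()
BlockGuard⇒∉ (inj₂ (_ , L≤x)) a<L x∈a = <⇒≱ (All.lookup a<L x∈a) L≤x

BlockGuard⇒noPush : ∀ {L Q a x} → BlockGuard L Q a x → All (_< L) a → All (λ y → suc y ≢ Q) a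
BlockGuard⇒noPush (inj₁ refl) _ = []
BlockGuard⇒noPush (inj₂ (L<Q , _)) a<L = below⇒noPush _ _ _ L<Q a<L

runOutput-matches-interleave : ∀ L Q a ss x w R → L ≤ Q → BlockGuard L Q a x → All (_< L) a →
  All (All (_< L)) ss → All NonEmpty ss → All (_< x) w →
  runOutput x w ++ R ≡ a ++ Q ∷ interleave (suc Q) ss → x ≡ Q × w ≡ a × R ≡ interleave (suc Q) ss
runOutput-matches-interleave L Q a ss x w R L≤Q guard a<L als nes w<x eq
  with ++-≡-++-split (runOutput x w) R a (Q ∷ interleave (suc Q) ss) eq
... | m , inj₂ (a≡ , _) = ⊥-elim (BlockGuard⇒∉ guard a<L (subst (x ∈_) (sym a≡) (∈-++⁺ˡ (∈-runOutput-head x w))))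
... | [] , inj₁ (E≡ , _) = ⊥-elim (BlockGuard⇒∉ guard a<L (subst (x ∈_) (trans E≡ (++-identityʳ a)) (∈-runOutput-head x w)))
... | _ ∷ [] , inj₁ (E≡ , e) with ∷-injective e
...   | refl , R≡ = let (x≡Q , w≡a) = runOutput≡∷ʳ⇒bypassed x w a Q w<x (BlockGuard⇒noPush guard a<L) E≡
                    in x≡Q , w≡a , sym R≡
runOutput-matches-interleave L Q a ss x w R L≤Q guard a<L als nes w<x eq | _ ∷ t ∷ T₁ , inj₁ (E≡ , e)
  with ∷-injective e
...   | refl , T≡ = ⊥-elim (runOutput≢interleave-prefix L Q ss x w a (t ∷ T₁) R L≤Q als nes w<x E≡ tt T≡)

psb≡interleave⇒canonical : ∀ L Q a ss ρ → L ≤ Q → (a ≡ [] ⊎ (L < Q × EndsRun L ρ)) → All (_< L) a →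
  All (All (_< L)) ss → All NonEmpty ss → Unique (interleave Q (a ∷ ss)) →
  psb ρ ≡ interleave Q (a ∷ ss) → ρ ≡ runsInput (canonicalRuns Q (a ∷ ss))
psb≡interleave⇒canonical L Q a ss [] _ _ _ _ _ _ eq = ⊥-elim (++-∷≢[] a Q _ (sym eq))
psb≡interleave⇒canonical L Q a ss (x ∷ xs) L≤Q guard a<L als nes U eq
  with psb-firstRun x xs (Unique-resp-↭ (psb-↭ (x ∷ xs)) (subst Unique (sym eq) U))
... | w , r , refl , w<x , r-ends , psb≡
  with runOutput-matches-interleave L Q a ss x w (psb r) L≤Q guard a<L als nes w<x (trans (sym psb≡) eq)
...   | refl , refl , psb-r≡ = cong (λ t → x ∷ w ++ t) (rest ss als nes (Unique-tail (Unique-++⁻ʳ w U)) psb-r≡)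
  where
  rest : ∀ ss → All (All (_< L)) ss → All NonEmpty ss → Unique (interleave (suc x) ss) →
    psb r ≡ interleave (suc x) ss → r ≡ runsInput (canonicalRuns (suc x) ss)
  rest [] _ _ _ e = psb≡[]⇒≡[] r e
  rest (a′ ∷ ss′) (a′<L ∷ als′) (_ ∷ nes′) U′ e =
    psb≡interleave⇒canonical L (suc x) a′ ss′ r (m≤n⇒m≤1+n L≤Q)
      (inj₂ (s≤s L≤Q , EndsRun-≤ r (m≤n⇒m≤1+n L≤Q) r-ends)) a′<L als′ nes′ U′ e

C1Shape⇒uniquePreimage : ∀ n σ → C1Shape n σ → HasUniquePreimage n σ
C1Shape⇒uniquePreimage n σ (perm , M , ss , refl , nes , als) =
  perm , canonicalPreimage M ss , ↭-trans (canonicalPreimage-↭ M ss) perm , psb-canonicalPreimage M ss als ,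
  λ π′ _ e → psb≡interleave⇒canonical M M [] ss π′ ≤-refl (inj₁ refl) [] als nes (IsPerm⇒Unique perm) e

-- Rigidity of the runs of a unique preimage

Rigid : List Run → Set
Rigid runs = ∀ runs′ → ValidRuns 0 runs′ → runsInput runs′ ↭ runsInput runs →
  runsOutput runs′ ≡ runsOutput runs → runsInput runs′ ≡ runsInput runs

module RigidRuns (runs : List Run) (strict : StrictRuns 0 runs) (unique : Unique (runsInput runs)) (rigid : Rigid runs) where

  valid : ValidRuns 0 runs
  valid = StrictRuns⇒ValidRuns 0 0 runs z≤n strict unique

  rigid-suffix : ∀ pre rest rest′ → runs ≡ pre ++ rest →
    (ValidRuns (lastHead 0 pre) rest → ValidRuns (lastHead 0 pre) rest′) →
    runsInput rest′ ↭ runsInput rest → runsOutput rest′ ≡ runsOutput rest → runsInput rest′ ≡ runsInput rest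
  rigid-suffix pre rest rest′ runs≡ valid-rest′ input↭ output≡ = ++-cancelˡ (runsInput pre) _ _ (begin
    runsInput pre ++ runsInput rest′  ≡⟨ runsInput-++ pre rest′ ⟨
    runsInput (pre ++ rest′)          ≡⟨ rigid (pre ++ rest′) valid′ input′↭ output′≡ ⟩
    runsInput runs                    ≡⟨ cong runsInput runs≡ ⟩
    runsInput (pre ++ rest)           ≡⟨ runsInput-++ pre rest ⟩
    runsInput pre ++ runsInput rest   ∎)
    where
    valid′ : ValidRuns 0 (pre ++ rest′)
    valid′ = ValidRuns-replaceSuffix 0 pre rest rest′ (subst (ValidRuns 0) runs≡ valid) valid-rest′
    input′↭ : runsInput (pre ++ rest′) ↭ runsInput runs
    input′↭ = ↭-trans (↭-reflexive (runsInput-++ pre rest′)) (↭-trans (++⁺ˡ (runsInput pre) input↭)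
               (↭-reflexive (trans (sym (runsInput-++ pre rest)) (cong runsInput (sym runs≡)))))
    output′≡ : runsOutput (pre ++ rest′) ≡ runsOutput runs
    output′≡ = trans (runsOutput-++ pre rest′)
                 (trans (cong (runsOutput pre ++_) output≡) (trans (sym (runsOutput-++ pre rest)) (cong runsOutput (sym runs≡))))

  -- Otherwise P and its bypassed block wp could be moved into the next run, bypassing its head M′.
  next-head≡suc : ∀ pre P wp M′ w′ rest → runs ≡ pre ++ (P , wp) ∷ (M′ , w′) ∷ rest →
    All (_< P) wp → suc P ≤ M′ → All (λ x → suc x ≢ P) wp → suc P ≡ M′
  next-head≡suc pre P wp M′ w′ rest runs≡ wp<P P<M′ wp-bypass with suc P ≟ M′
  ... | yes e = e
  ... | no P+1≢M′ = ⊥-elim (<-irrefl (sym (∷-injectiveˡ (rigid-suffix pre _ _ runs≡ valid-merged input↭ output≡))) P<M′)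
    where
    P+1<M′ : suc P < M′
    P+1<M′ = ≤∧≢⇒< P<M′ P+1≢M′
    wp-bypass-M′ : All (λ x → suc x < M′) wp
    wp-bypass-M′ = All.map (λ z → <-≤-trans (s≤s z) P<M′) wp<P
    valid-merged : ∀ {h} → ValidRuns h ((P , wp) ∷ (M′ , w′) ∷ rest) → ValidRuns h ((M′ , wp ++ P ∷ w′) ∷ rest)
    valid-merged (h≤P , _ , (_ , popFree , valid-rest)) =
      ≤-trans h≤P (<⇒≤ P<M′) , PopFree-++-bypassing M′ wp (P ∷ w′) wp-bypass-M′ (inj₂ (P+1<M′ , popFree)) , valid-rest
    input↭ : M′ ∷ (wp ++ P ∷ w′) ++ runsInput rest ↭ P ∷ wp ++ M′ ∷ w′ ++ runsInput rest
    input↭ = ↭-trans (↭-reflexive (cong (M′ ∷_) (++-assoc wp (P ∷ w′) (runsInput rest))))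
                     (↭-sym (↭-exchange M′ P wp (w′ ++ runsInput rest)))
    wpP-noPush : All (λ x → suc x ≢ M′) (wp ∷ʳ P)
    wpP-noPush = All.++⁺ (All.map (λ z e → <-irrefl e z) wp-bypass-M′) ((λ e → <-irrefl e P+1<M′) ∷ [])
    output≡ : runsOutput ((M′ , wp ++ P ∷ w′) ∷ rest) ≡ runsOutput ((P , wp) ∷ (M′ , w′) ∷ rest)
    output≡ = begin
      runOutput M′ (wp ++ P ∷ w′) ++ runsOutput rest
        ≡⟨ cong (λ z → runOutput M′ z ++ runsOutput rest) (sym (++-assoc wp (P ∷ []) w′)) ⟩
      runOutput M′ ((wp ∷ʳ P) ++ w′) ++ runsOutput rest
        ≡⟨ cong (_++ runsOutput rest) (runOutput-++-bypassing M′ (wp ∷ʳ P) w′ wpP-noPush) ⟩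
      ((wp ∷ʳ P) ++ runOutput M′ w′) ++ runsOutput rest
        ≡⟨ ++-assoc (wp ∷ʳ P) (runOutput M′ w′) (runsOutput rest) ⟩
      (wp ∷ʳ P) ++ runOutput M′ w′ ++ runsOutput rest
        ≡⟨ cong (_++ runOutput M′ w′ ++ runsOutput rest) (sym (runOutput-bypassing P wp wp-bypass)) ⟩
      runOutput P wp ++ runOutput M′ w′ ++ runsOutput rest ∎

  -- Otherwise P and wp could be moved into the empty run of P + 1, with P pushed under it.
  successor-run-nonempty : ∀ pre P wp rest → runs ≡ pre ++ (P , wp) ∷ (suc P , []) ∷ rest →
    All (_< P) wp → All (λ x → suc x ≢ P) wp → ⊥
  successor-run-nonempty pre P wp rest runs≡ wp<P wp-bypass =
    <-irrefl (sym (∷-injectiveˡ (rigid-suffix pre _ _ runs≡ valid-merged input↭ output≡))) (n<1+n P)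
    where
    valid-merged : ∀ {h} → ValidRuns h ((P , wp) ∷ (suc P , []) ∷ rest) → ValidRuns h ((suc P , wp ∷ʳ P) ∷ rest)
    valid-merged (h≤P , _ , (_ , _ , valid-rest)) =
      ≤-trans h≤P (n≤1+n P) , PopFree-++-bypassing (suc P) wp (P ∷ []) (All.map s≤s wp<P) (inj₁ (refl , tt)) , valid-rest
    input↭ : suc P ∷ (wp ∷ʳ P) ++ runsInput rest ↭ P ∷ wp ++ suc P ∷ runsInput rest
    input↭ = ↭-trans (↭-reflexive (cong (suc P ∷_) (++-assoc wp (P ∷ []) (runsInput rest))))
                     (↭-sym (↭-exchange (suc P) P wp (runsInput rest)))
    output≡ : runsOutput ((suc P , wp ∷ʳ P) ∷ rest) ≡ runsOutput ((P , wp) ∷ (suc P , []) ∷ rest)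
    output≡ = begin
      runOutput (suc P) (wp ∷ʳ P) ++ runsOutput rest
        ≡⟨ cong (_++ runsOutput rest) (runOutput-++-bypassing (suc P) wp (P ∷ []) (All.map (λ z e → <-irrefl (suc-injective e) z) wp<P)) ⟩
      (wp ++ runOutput (suc P) (P ∷ [])) ++ runsOutput rest
        ≡⟨ cong (λ z → (wp ++ z) ++ runsOutput rest) (runOutput-pred P) ⟩
      (wp ++ P ∷ suc P ∷ []) ++ runsOutput rest
        ≡⟨ ++-assoc wp (P ∷ suc P ∷ []) (runsOutput rest) ⟩
      wp ++ P ∷ suc P ∷ runsOutput rest
        ≡⟨ sym (++-assoc wp (P ∷ []) (suc P ∷ runsOutput rest)) ⟩
      (wp ∷ʳ P) ++ suc P ∷ runsOutput rest
        ≡⟨ cong (_++ suc P ∷ runsOutput rest) (sym (runOutput-bypassing P wp wp-bypass)) ⟩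
      runOutput P wp ++ suc P ∷ runsOutput rest ∎

  -- Otherwise the first entry b of the body could be split off into a run of its own:
  -- in front of the run of M if b bypasses M, and behind it as the run b, b + 1 = M if it is pushed.
  first-run-body≡[] : ∀ M w rest → runs ≡ (M , w) ∷ rest → w ≡ []
  first-run-body≡[] M [] rest runs≡ = refl
  first-run-body≡[] M (b ∷ w′) rest runs≡ with suc b ≟ M | subst (ValidRuns 0) runs≡ valid
  ... | yes b+1≡M | (_ , inj₂ (b+1<M , _) , _) = ⊥-elim (<-irrefl b+1≡M b+1<M)
  ... | no b+1≢M | (_ , inj₁ (b+1≡M , _) , _) = ⊥-elim (b+1≢M b+1≡M)
  ... | yes refl | (_ , inj₁ (_ , popFree) , valid-rest) =
    ⊥-elim (<-irrefl (∷-injectiveˡ (rigid-suffix [] _ ((b , w′) ∷ (suc b , []) ∷ rest) runs≡ valid-split input↭ output≡)) (n<1+n b))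
    where
    valid-split : ValidRuns 0 ((suc b , b ∷ w′) ∷ rest) → ValidRuns 0 ((b , w′) ∷ (suc b , []) ∷ rest)
    valid-split _ = z≤n , popFree , n≤1+n b , tt , valid-rest
    input↭ : b ∷ w′ ++ suc b ∷ runsInput rest ↭ suc b ∷ b ∷ w′ ++ runsInput rest
    input↭ = ↭-trans (prep b (shift (suc b) w′ (runsInput rest))) (swap b (suc b) ↭-refl)
    output≡ : runOutput b w′ ++ suc b ∷ runsOutput rest ≡ runOutput (suc b) (b ∷ w′) ++ runsOutput rest
    output≡ with suc b ≟ suc b
    ... | yes _ = sym (++-assoc (runOutput b w′) (suc b ∷ []) (runsOutput rest))
    ... | no b+1≢b+1 = ⊥-elim (b+1≢b+1 refl)
  ... | no b+1≢M | (_ , inj₂ (b+1<M , popFree) , valid-rest) =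
    ⊥-elim (<-irrefl (∷-injectiveˡ (rigid-suffix [] _ ((b , []) ∷ (M , w′) ∷ rest) runs≡ valid-split (swap b M ↭-refl) output≡))
                     (<-trans (n<1+n b) b+1<M))
    where
    valid-split : ValidRuns 0 ((M , b ∷ w′) ∷ rest) → ValidRuns 0 ((b , []) ∷ (M , w′) ∷ rest)
    valid-split _ = z≤n , tt , <⇒≤ (<-trans (n<1+n b) b+1<M) , popFree , valid-rest
    output≡ : b ∷ runOutput M w′ ++ runsOutput rest ≡ runOutput M (b ∷ w′) ++ runsOutput rest
    output≡ with suc b ≟ M
    ... | yes b+1≡M = ⊥-elim (b+1≢M b+1≡M)
    ... | no _ = refl

  -- All values M, …, P already occur up to the run of P, so later bodies consist of
  -- values below M, and the heads continue P + 1, P + 2, ….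
  runs-canonical : ∀ M pre P wp rest → runs ≡ pre ++ (P , wp) ∷ rest → All (_< P) wp → StrictRuns (suc P) rest →
    All (λ x → suc x ≢ P) wp → (∀ u → M ≤ u → u ≤ P → u ∈ runsInput (pre ∷ʳ (P , wp))) → M ≤ P →
    ∃ λ ss → rest ≡ canonicalRuns (suc P) ss × All NonEmpty ss × All (All (_< M)) ss
  runs-canonical M pre P wp [] _ _ _ _ _ _ = [] , refl , [] , []
  runs-canonical M pre P wp ((M′ , []) ∷ rest) runs≡ wp<P (P<M′ , _ , _) wp-bypass _ _
    with next-head≡suc pre P wp M′ [] rest runs≡ wp<P P<M′ wp-bypass
  ... | refl = ⊥-elim (successor-run-nonempty pre P wp rest runs≡ wp<P wp-bypass)
  runs-canonical M pre P wp ((M′ , w′@(_ ∷ _)) ∷ rest) runs≡ wp<P (P<M′ , w′<M′ , strict) wp-bypass covered M≤P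
    with next-head≡suc pre P wp M′ w′ rest runs≡ wp<P P<M′ wp-bypass
  ... | refl = let (ss , rest≡ , nes , als) = runs-canonical M pre′ (suc P) w′ rest runs≡′ w′<M′ strict w′-bypass covered′ (m≤n⇒m≤1+n M≤P)
               in w′ ∷ ss , cong ((suc P , w′) ∷_) rest≡ , tt ∷ nes , w′<M ∷ als
    where
    pre′ = pre ∷ʳ (P , wp)
    runs≡′ : runs ≡ pre′ ++ (suc P , w′) ∷ rest
    runs≡′ = trans runs≡ (sym (++-assoc pre ((P , wp) ∷ []) _))
    unique′ : Unique (runsInput pre′ ++ runsInput ((suc P , w′) ∷ rest))
    unique′ = subst Unique (trans (cong runsInput runs≡′) (runsInput-++ pre′ _)) unique
    w′<M : All (_< M) w′
    w′<M = All.tabulate λ {x} x∈ → ≰⇒> λ M≤x →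
      Unique-++-disjoint (runsInput pre′) unique′ (covered x M≤x (≤-pred (All.lookup w′<M′ x∈))) (there (∈-++⁺ˡ x∈))
    w′-bypass : All (λ x → suc x ≢ suc P) w′
    w′-bypass = All.map (λ z e → <-irrefl (suc-injective e) (<-≤-trans z M≤P)) w′<M
    covered′ : ∀ u → M ≤ u → u ≤ suc P → u ∈ runsInput (pre′ ∷ʳ (suc P , w′))
    covered′ u M≤u u≤P+1 with u ≟ suc P
    ... | yes refl = subst (u ∈_) (sym (runsInput-++ pre′ _)) (∈-++⁺ʳ (runsInput pre′) (here refl))
    ... | no u≢P+1 = subst (u ∈_) (sym (runsInput-++ pre′ _)) (∈-++⁺ˡ (covered u M≤u (≤-pred (≤∧≢⇒< u≤P+1 u≢P+1))))

uniquePreimage⇒Rigid : ∀ {n σ π} runs → IsPerm n π → psb π ≡ σ → (∀ π′ → IsPerm n π′ → psb π′ ≡ σ → π′ ≡ π) →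
  runsInput runs ≡ π → ValidRuns 0 runs → Rigid runs
uniquePreimage⇒Rigid runs permπ psbπ unique refl valid runs′ valid′ input↭ output≡ =
  unique (runsInput runs′) (↭-trans input↭ permπ)
    (trans (psb-runsInput 0 runs′ valid′) (trans output≡ (trans (sym (psb-runsInput 0 runs valid)) psbπ)))

rigid-runs-canonical : ∀ M w rest → Unique (runsInput ((M , w) ∷ rest)) → StrictRuns 0 ((M , w) ∷ rest) →
  Rigid ((M , w) ∷ rest) → w ≡ [] × ∃ λ ss → rest ≡ canonicalRuns (suc M) ss × All NonEmpty ss × All (All (_< M)) ss
rigid-runs-canonical M w rest unique strict rigid with first-run-body≡[] M w rest refl
  where open RigidRuns _ strict unique rigid
... | refl = refl , runs-canonical M [] M [] rest refl [] (proj₂ (proj₂ strict)) [] (λ u M≤u u≤M → here (≤-antisym u≤M M≤u)) ≤-refl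
  where open RigidRuns _ strict unique rigid

uniquePreimage⇒C1Shape : ∀ n σ → 1 ≤ n → HasUniquePreimage n σ → C1Shape n σ
uniquePreimage⇒C1Shape (suc n) σ _ (permσ , π , permπ , psbπ , unique)
  with runsOf π | runsInput-runsOf π | runsOf-strict π (IsPerm⇒Unique permπ)
... | [] | refl | _ with ↭-empty-inv (↭-sym permπ)
...   | ()
uniquePreimage⇒C1Shape (suc n) σ _ (permσ , π , permπ , psbπ , unique) | (M , w) ∷ rest | π≡ | strict
  with rigid-runs-canonical M w rest uniqueRuns strict
         (uniquePreimage⇒Rigid ((M , w) ∷ rest) permπ psbπ unique π≡ (StrictRuns⇒ValidRuns 0 0 _ z≤n strict uniqueRuns))
  where
  uniqueRuns : Unique (runsInput ((M , w) ∷ rest))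
  uniqueRuns = subst Unique (sym π≡) (IsPerm⇒Unique permπ)
...   | refl , ss , refl , nes , als =
  permσ , M , ss , trans (sym psbπ) (trans (cong psb (sym π≡)) (psb-canonicalPreimage M ss als)) , nes , als

-- Left-to-right maxima

lookup-index-unique : ∀ {l} pre (v : ℕ) post → l ≡ pre ++ v ∷ post → Unique l →
  (i : Fin (length l)) → lookup l i ≡ v → toℕ i ≡ length pre
lookup-index-unique [] v post refl u F.zero e = refl
lookup-index-unique [] v post refl u (F.suc i) e = ⊥-elim (Unique[x∷xs]⇒x∉xs u (subst (_∈ post) e (∈-lookup i)))
lookup-index-unique (p ∷ pre) v post refl u F.zero refl = ⊥-elim (Unique[x∷xs]⇒x∉xs u (∈-++⁺ʳ pre (here refl)))
lookup-index-unique (p ∷ pre) v post refl u (F.suc i) e = cong suc (lookup-index-unique pre v post refl (Unique-tail u) i e)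

∈LTR-prefixMax : ∀ {σ} pre (v : ℕ) post → σ ≡ pre ++ v ∷ post → All (_≤ v) pre → v ∈LTR σ
∈LTR-prefixMax [] v post refl [] = F.zero , refl , λ { F.zero _ → ≤-refl }
∈LTR-prefixMax (p ∷ pre) v post refl (p≤v ∷ al) with ∈LTR-prefixMax pre v post refl al
... | i , e , ltr = F.suc i , e , λ { F.zero _ → subst (p ≤_) (sym e) p≤v ; (F.suc j) (s≤s h) → ltr j h }

∈LTR-dominates : ∀ {σ} pre (x : ℕ) post → σ ≡ pre ++ x ∷ post → Unique σ → x ∈LTR σ → All (_≤ x) pre
∈LTR-dominates [] x post refl u _ = []
∈LTR-dominates (p ∷ pre) x post refl u (F.zero , refl , ltr) = ⊥-elim (Unique[x∷xs]⇒x∉xs u (∈-++⁺ʳ pre (here refl)))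
∈LTR-dominates (p ∷ pre) x post refl u (F.suc i , e , ltr) =
  subst (p ≤_) e (ltr F.zero z≤n) ∷ ∈LTR-dominates pre x post refl (Unique-tail u) (i , e , λ j h → ltr (F.suc j) (s≤s h))

∈LTR⇒head≤ : ∀ {v} (h : ℕ) t → v ∈LTR (h ∷ t) → h ≤ v
∈LTR⇒head≤ h t (i , e , ltr) = subst (h ≤_) e (ltr F.zero z≤n)

∈LTR-apart : ∀ {σ} pre (x y : ℕ) post → σ ≡ pre ++ x ∷ y ∷ post → Unique σ → x ∈LTR σ → y ∈LTR σ →
  ¬ (∀ (i j : Fin (length σ)) → IsLTRPos σ i → IsLTRPos σ j → lookup σ i ≢ lookup σ j → 1 < ∣ toℕ j - toℕ i ∣)
∈LTR-apart {σ} pre x y post σ≡ u (i , ei , li) (j , ej , lj) apart = <-irrefl (sym distance) (apart i j li lj x≢y)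
  where
  x≢y : lookup σ i ≢ lookup σ j
  x≢y e = Unique[x∷xs]⇒x∉xs (Unique-++⁻ʳ pre (subst Unique σ≡ u)) (here (trans (sym ei) (trans e ej)))
  distance : ∣ toℕ j - toℕ i ∣ ≡ 1
  distance = begin
    ∣ toℕ j - toℕ i ∣
      ≡⟨ cong₂ ∣_-_∣ (lookup-index-unique (pre ∷ʳ x) y post (trans σ≡ (sym (++-assoc pre _ _))) u j ej)
                     (lookup-index-unique pre x (y ∷ post) σ≡ u i ei) ⟩
    ∣ length (pre ∷ʳ x) - length pre ∣  ≡⟨ cong (λ m → ∣ m - length pre ∣) (length-++ pre) ⟩
    ∣ length pre + 1 - length pre ∣     ≡⟨ ∣-∣-comm (length pre + 1) (length pre) ⟩
    ∣ length pre - length pre + 1 ∣     ≡⟨ ∣m-m+n∣≡n (length pre) 1 ⟩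
    1                                   ∎

NoAdjacentAbove : ℕ → List ℕ → Set
NoAdjacentAbove M [] = ⊤
NoAdjacentAbove M (x ∷ []) = ⊤
NoAdjacentAbove M (x ∷ y ∷ r) = ¬ (M ≤ x × M ≤ y) × NoAdjacentAbove M (y ∷ r)

NoAdjacentAbove-lookup : ∀ M l → NoAdjacentAbove M l → ∀ (i j : Fin (length l)) → toℕ j ≡ suc (toℕ i) →
  M ≤ lookup l i → M ≤ lookup l j → ⊥
NoAdjacentAbove-lookup M (x ∷ y ∷ r) (na , _) F.zero (F.suc F.zero) e bi bj = na (bi , bj)
NoAdjacentAbove-lookup M (x ∷ y ∷ r) (_ , na) (F.suc i) (F.suc j) e bi bj = NoAdjacentAbove-lookup M (y ∷ r) na i j (suc-injective e) bi bj
NoAdjacentAbove-lookup M (x ∷ y ∷ r) na F.zero (F.suc (F.suc j)) () bi bj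
NoAdjacentAbove-lookup M (x ∷ y ∷ r) na (F.suc i) F.zero () bi bj
NoAdjacentAbove-lookup M (x ∷ []) na F.zero (F.suc ()) e bi bj
NoAdjacentAbove-lookup M (x ∷ []) na F.zero F.zero () bi bj

∣-∣≤1⇒adjacent : ∀ a b → a ≢ b → ∣ b - a ∣ ≤ 1 → b ≡ suc a ⊎ a ≡ suc b
∣-∣≤1⇒adjacent zero zero ne _ = ⊥-elim (ne refl)
∣-∣≤1⇒adjacent zero (suc zero) ne _ = inj₁ refl
∣-∣≤1⇒adjacent zero (suc (suc b)) ne (s≤s ())
∣-∣≤1⇒adjacent (suc zero) zero ne _ = inj₂ refl
∣-∣≤1⇒adjacent (suc (suc a)) zero ne (s≤s ())
∣-∣≤1⇒adjacent (suc a) (suc b) ne le with ∣-∣≤1⇒adjacent a b (λ e → ne (cong suc e)) le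
... | inj₁ e = inj₁ (cong suc e)
... | inj₂ e = inj₂ (cong suc e)

NoAdjacentAbove⇒LTR-apart : ∀ M σ → NoAdjacentAbove M σ → (∀ i → IsLTRPos σ i → M ≤ lookup σ i) →
  ∀ (i j : Fin (length σ)) → IsLTRPos σ i → IsLTRPos σ j → lookup σ i ≢ lookup σ j → 1 < ∣ toℕ j - toℕ i ∣
NoAdjacentAbove⇒LTR-apart M σ na big i j li lj ne with 1 <? ∣ toℕ j - toℕ i ∣
... | yes lt = lt
... | no nlt with ∣-∣≤1⇒adjacent (toℕ i) (toℕ j) (λ e → ne (cong (lookup σ) (F.toℕ-injective e))) (≮⇒≥ nlt)
...   | inj₁ e = ⊥-elim (NoAdjacentAbove-lookup M σ na i j e (big i li) (big j lj))
...   | inj₂ e = ⊥-elim (NoAdjacentAbove-lookup M σ na j i e (big j lj) (big i li))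

interleave-last : ∀ M ss → ∃ λ ρ → M ∷ interleave (suc M) ss ≡ ρ ∷ʳ (M + length ss)
interleave-last M [] = [] , cong (_∷ []) (sym (+-identityʳ M))
interleave-last M (a ∷ ss) with interleave-last (suc M) ss
... | ρ , e = M ∷ a ++ ρ , (begin
  M ∷ a ++ suc M ∷ interleave (suc (suc M)) ss  ≡⟨ cong (λ z → M ∷ a ++ z) e ⟩
  M ∷ a ++ ρ ∷ʳ (suc M + length ss)             ≡⟨ cong (M ∷_) (sym (++-assoc a ρ _)) ⟩
  (M ∷ a ++ ρ) ∷ʳ (suc M + length ss)           ≡⟨ cong ((M ∷ a ++ ρ) ∷ʳ_) (sym (+-suc M (length ss))) ⟩
  (M ∷ a ++ ρ) ∷ʳ (M + suc (length ss))         ∎)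

interleave-bound : ∀ L Q ss → L ≤ Q → All (All (_< L)) ss → All (_< Q + length ss) (interleave Q ss)
interleave-bound L Q [] _ _ = []
interleave-bound L Q (a ∷ ss) LQ (al ∷ als) =
  All.++⁺ (All.map (λ z → <-≤-trans z (≤-trans LQ (m≤m+n Q _))) al)
    (m<m+n Q (s≤s z≤n)
    ∷ All.map (λ z → ≤-trans z (≤-reflexive (sym (+-suc Q (length ss))))) (interleave-bound L (suc Q) ss (m≤n⇒m≤1+n LQ) als))

interleave-find : ∀ L Q ss v → L ≤ Q → All (All (_< L)) ss → Q ≤ v → v < Q + length ss →
  ∃₂ λ pre post → interleave Q ss ≡ pre ++ v ∷ post × All (_≤ v) pre
interleave-find L Q [] v LQ als Qv vl = ⊥-elim (<⇒≱ vl (≤-trans (≤-reflexive (+-identityʳ Q)) Qv))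
interleave-find L Q (a ∷ ss) v LQ (al ∷ als) Qv vl with Q ≟ v
... | yes refl = a , interleave (suc Q) ss , refl , All.map (λ z → <⇒≤ (<-≤-trans z LQ)) al
... | no ne with interleave-find L (suc Q) ss v (m≤n⇒m≤1+n LQ) als (≤∧≢⇒< Qv ne) (≤-trans vl (≤-reflexive (+-suc Q (length ss))))
...   | pre , post , e , ap = a ++ Q ∷ pre , post ,
          trans (cong (λ z → a ++ Q ∷ z) e) (sym (++-assoc a (Q ∷ pre) _)) ,
          All.++⁺ (All.map (λ z → <⇒≤ (<-≤-trans z (≤-trans LQ Qv))) al) (Qv ∷ ap)

NoAdjacentAbove-++ : ∀ M x a z r → NonEmpty a → All (_< M) a → NoAdjacentAbove M (z ∷ r) → NoAdjacentAbove M (x ∷ a ++ z ∷ r)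
NoAdjacentAbove-++ M x (y ∷ []) z r _ (yM ∷ []) na = (λ (_ , My) → <⇒≱ yM My) , (λ (My , _) → <⇒≱ yM My) , na
NoAdjacentAbove-++ M x (y ∷ y′ ∷ a) z r _ (yM ∷ al) na = (λ (_ , My) → <⇒≱ yM My) , NoAdjacentAbove-++ M y (y′ ∷ a) z r tt al na

NoAdjacentAbove-interleave : ∀ M x Q ss → All NonEmpty ss → All (All (_< M)) ss → NoAdjacentAbove M (x ∷ interleave Q ss)
NoAdjacentAbove-interleave M x Q [] _ _ = tt
NoAdjacentAbove-interleave M x Q (a ∷ ss) (ne ∷ nes) (al ∷ als) =
  NoAdjacentAbove-++ M x a Q (interleave (suc Q) ss) ne al (NoAdjacentAbove-interleave M Q (suc Q) ss nes als)

interleave-top : ∀ n M ss → 1 ≤ n → IsPerm n (M ∷ interleave (suc M) ss) → All (All (_< M)) ss → M + length ss ≡ n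
interleave-top n M ss n1 p als = ≤-antisym top≤n n≤top
  where
  top≤n : M + length ss ≤ n
  top≤n with interleave-last M ss
  ... | ρ , e = proj₂ (IsPerm-∈⁻ p (subst (M + length ss ∈_) (sym e) (∈-∷ʳ ρ _)))
  bounded : All (_≤ M + length ss) (M ∷ interleave (suc M) ss)
  bounded = m≤m+n M _ ∷ All.map ≤-pred (interleave-bound M (suc M) ss (n≤1+n M) als)
  n≤top : n ≤ M + length ss
  n≤top = All.lookup bounded (IsPerm-∈⁺ p n1 ≤-refl)

C1Shape⇒C1Condition : ∀ n σ → 1 ≤ n → C1Shape n σ → C1Condition n σ
C1Shape⇒C1Condition n σ n1 (p , M , ss , refl , nes , als) =
  (ρ , trans last≡ (cong (ρ ∷ʳ_) top≡n)) ,
  (length ss , λ v → mk⇔ (LTR⇒range v) (range⇒LTR v)) ,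
  NoAdjacentAbove⇒LTR-apart M σ (NoAdjacentAbove-interleave M M (suc M) ss nes als) (λ i li → li F.zero z≤n)
  where
  top≡n : M + length ss ≡ n
  top≡n = interleave-top n M ss n1 p als
  n∸k≡M : n ∸ length ss ≡ M
  n∸k≡M = trans (cong (_∸ length ss) (sym top≡n)) (m+n∸n≡m M (length ss))
  ρ = proj₁ (interleave-last M ss)
  last≡ = proj₂ (interleave-last M ss)
  LTR⇒range : ∀ v → v ∈LTR σ → n ∸ length ss ≤ v × v ≤ n
  LTR⇒range v ltr@(i , e , _) =
    subst (_≤ v) (sym n∸k≡M) (∈LTR⇒head≤ M _ ltr) , proj₂ (IsPerm-∈⁻ p (subst (_∈ σ) e (∈-lookup i)))
  range⇒LTR : ∀ v → n ∸ length ss ≤ v × v ≤ n → v ∈LTR σ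
  range⇒LTR v (lo , hi) with M ≟ v
  ... | yes refl = ∈LTR-prefixMax [] M _ refl []
  ... | no M≢v with interleave-find M (suc M) ss v (n≤1+n M) als (≤∧≢⇒< (subst (_≤ v) n∸k≡M lo) M≢v)
                       (s≤s (≤-trans hi (≤-reflexive (sym top≡n))))
  ...   | pre , post , e , ap = ∈LTR-prefixMax (M ∷ pre) v post (cong (M ∷_) e) (subst (_≤ v) n∸k≡M lo ∷ ap)

first-≥ : ∀ M (l : List ℕ) → Any (M ≤_) l → ∃ λ a → ∃₂ λ z rest → l ≡ a ++ z ∷ rest × All (_< M) a × M ≤ z
first-≥ M (x ∷ xs) an with M ≤? x
... | yes M≤x = [] , x , xs , refl , [] , M≤x
... | no M≰x with an
...   | here M≤x = ⊥-elim (M≰x M≤x)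
...   | there an′ with first-≥ M xs an′
...     | a , z , rest , e , al , M≤z = x ∷ a , z , rest , cong (x ∷_) e , ≰⇒> M≰x ∷ al , M≤z

record Parsable (M n Q : ℕ) (l : List ℕ) : Set where
  field
    unique       : Unique l
    M≤Q          : M ≤ Q
    values       : All (λ x → x < M ⊎ (Q ≤ x × x ≤ n)) l
    complete     : ∀ u → Q ≤ u → u ≤ n → u ∈ l
    bigDominates : ∀ pre x post → l ≡ pre ++ x ∷ post → M ≤ x → All (_≤ x) pre
    bigApart     : ∀ pre x y post → l ≡ pre ++ x ∷ y ∷ post → M ≤ x → M ≤ y → ⊥
    headSmall    : ∀ y r → l ≡ y ∷ r → y < M
    lastBig      : ∀ r y → l ≡ r ∷ʳ y → M ≤ y

Parsable-step : ∀ {M n Q} a z rest → Parsable M n Q (a ++ z ∷ rest) → All (_< M) a → M ≤ z →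
  z ≡ Q × Parsable M n (suc Q) rest
Parsable-step {M} {n} {Q} a z rest ps a<M M≤z = z≡Q , record
  { unique = Unique-tail u-zrest
  ; M≤Q = m≤n⇒m≤1+n M≤Q
  ; values = All.tabulate λ x∈ → shrink x∈ (All.lookup values (∈-++⁺ʳ a (there x∈)))
  ; complete = complete′
  ; bigDominates = λ pre x post e M≤x → All.tail (All.++⁻ʳ a (bigDominates (a ++ z ∷ pre) x post (shift≡ e) M≤x))
  ; bigApart = λ pre x y post e → bigApart (a ++ z ∷ pre) x y post (shift≡ e)
  ; headSmall = headSmall′
  ; lastBig = λ r y e → lastBig (a ++ z ∷ r) y (shift≡ e)
  }
  where
  open Parsable ps
  u-zrest : Unique (z ∷ rest)
  u-zrest = Unique-++⁻ʳ a unique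
  shift≡ : ∀ {pre} {t : List ℕ} → rest ≡ pre ++ t → a ++ z ∷ rest ≡ (a ++ z ∷ pre) ++ t
  shift≡ {pre} {t} e = trans (cong (λ s → a ++ z ∷ s) e) (sym (++-assoc a (z ∷ pre) t))
  z-range : Q ≤ z × z ≤ n
  z-range with All.lookup values (∈-++⁺ʳ a (here refl))
  ... | inj₁ z<M = ⊥-elim (<⇒≱ z<M M≤z)
  ... | inj₂ r = r
  z≡Q : z ≡ Q
  z≡Q with ∈-++⁻ a (complete Q ≤-refl (≤-trans (proj₁ z-range) (proj₂ z-range)))
  ... | inj₁ Q∈a = ⊥-elim (<⇒≱ (All.lookup a<M Q∈a) M≤Q)
  ... | inj₂ (here e) = sym e
  ... | inj₂ (there Q∈rest) with ∈-∃++ Q∈rest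
  ...   | r₁ , r₂ , refl = ≤-antisym (All.lookup (bigDominates (a ++ z ∷ r₁) Q r₂ (shift≡ refl) M≤Q) (∈-++⁺ʳ a (here refl)))
                                     (proj₁ z-range)
  shrink : ∀ {x} → x ∈ rest → x < M ⊎ (Q ≤ x × x ≤ n) → x < M ⊎ (suc Q ≤ x × x ≤ n)
  shrink x∈ (inj₁ x<M) = inj₁ x<M
  shrink x∈ (inj₂ (Q≤x , x≤n)) =
    inj₂ (≤∧≢⇒< Q≤x (λ Q≡x → Unique[x∷xs]⇒x∉xs u-zrest (subst (_∈ rest) (trans (sym Q≡x) (sym z≡Q)) x∈)) , x≤n)
  complete′ : ∀ u → suc Q ≤ u → u ≤ n → u ∈ rest
  complete′ u Q<u u≤n with ∈-++⁻ a (complete u (<⇒≤ Q<u) u≤n)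
  ... | inj₁ u∈a = ⊥-elim (<⇒≱ (All.lookup a<M u∈a) (≤-trans M≤Q (<⇒≤ Q<u)))
  ... | inj₂ (here e) = ⊥-elim (<-irrefl (sym (trans e z≡Q)) Q<u)
  ... | inj₂ (there u∈rest) = u∈rest
  headSmall′ : ∀ y r → rest ≡ y ∷ r → y < M
  headSmall′ y r e with y <? M
  ... | yes y<M = y<M
  ... | no y≮M = ⊥-elim (bigApart a z y r (cong (λ s → a ++ z ∷ s) e) M≤z (≮⇒≥ y≮M))

Parsable⇒interleave : ∀ {M n} fuel l Q → length l ≤ fuel → Parsable M n Q l →
  ∃ λ ss → l ≡ interleave Q ss × All NonEmpty ss × All (All (_< M)) ss
Parsable⇒interleave fuel [] Q _ _ = [] , refl , [] , []
Parsable⇒interleave {M} (suc fuel) (y ∷ r) Q len ps with NonEmpty⇒∷ʳ (y ∷ r) tt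
... | r₀ , yₗ , l≡ with first-≥ M (y ∷ r) (Any.map (λ { refl → lastBig r₀ yₗ l≡ }) (subst (yₗ ∈_) (sym l≡) (∈-∷ʳ r₀ yₗ)))
  where open Parsable ps
... | [] , z , rest , refl , _ , M≤z = ⊥-elim (<⇒≱ (Parsable.headSmall ps y r refl) M≤z)
... | a@(_ ∷ _) , z , rest , l≡′ , a<M , M≤z with Parsable-step a z rest (subst (Parsable _ _ Q) l≡′ ps) a<M M≤z
...   | refl , ps′ with Parsable⇒interleave fuel rest (suc Q) (rest-shorter (subst (λ l → length l ≤ suc fuel) l≡′ len)) ps′
  where
  rest-shorter : length (a ++ z ∷ rest) ≤ suc fuel → length rest ≤ fuel
  rest-shorter le = ≤-pred (≤-trans (≤-trans (m≤n+m (suc (length rest)) (length a)) (≤-reflexive (sym (length-++ a)))) le)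
...     | ss , refl , nes , als = a ∷ ss , l≡′ , tt ∷ nes , a<M ∷ als

C1Condition⇒Parsable : ∀ n h t → IsPerm n (h ∷ t) → C1Condition n (h ∷ t) → Σ ℕ λ M → h ≡ M × Parsable M n (suc M) t
C1Condition⇒Parsable n h t p ((ρ , σ≡) , (k , LTR⇔range) , apart) = M , h≡M , record
  { unique = Unique-tail uσ
  ; M≤Q = n≤1+n M
  ; values = All.tabulate λ x∈ → classify x∈ (IsPerm-∈⁻ p (there x∈))
  ; complete = complete
  ; bigDominates = λ pre x post e M≤x → All.tail (dominates (h ∷ pre) x post (cong (h ∷_) e) M≤x)
  ; bigApart = λ pre x y post e → notAdjacent (h ∷ pre) x y post (cong (h ∷_) e)
  ; headSmall = headSmall
  ; lastBig = λ r y e → subst (M ≤_) (∷ʳ-injectiveʳ ρ (h ∷ r) (trans (sym σ≡) (cong (h ∷_) e))) (m∸n≤m n k)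
  }
  where
  M = n ∸ k
  σ = h ∷ t
  uσ : Unique σ
  uσ = IsPerm⇒Unique p
  big⇒LTR : ∀ pre x post → σ ≡ pre ++ x ∷ post → M ≤ x → x ∈LTR σ
  big⇒LTR pre x post e M≤x = Equivalence.from (LTR⇔range x)
    (M≤x , proj₂ (IsPerm-∈⁻ p (subst (x ∈_) (sym e) (∈-++⁺ʳ pre (here refl)))))
  h≡M : h ≡ M
  h≡M = ≤-antisym (∈LTR⇒head≤ h t (Equivalence.from (LTR⇔range M) (≤-refl , m∸n≤m n k)))
                  (proj₁ (Equivalence.to (LTR⇔range h) (∈LTR-prefixMax [] h t refl [])))
  dominates : ∀ pre x post → σ ≡ pre ++ x ∷ post → M ≤ x → All (_≤ x) pre
  dominates pre x post e M≤x = ∈LTR-dominates pre x post e uσ (big⇒LTR pre x post e M≤x)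
  notAdjacent : ∀ pre x y post → σ ≡ pre ++ x ∷ y ∷ post → M ≤ x → M ≤ y → ⊥
  notAdjacent pre x y post e M≤x M≤y = ∈LTR-apart pre x y post e uσ (big⇒LTR pre x (y ∷ post) e M≤x)
    (big⇒LTR (pre ∷ʳ x) y post (trans e (sym (++-assoc pre _ _))) M≤y) apart
  classify : ∀ {x} → x ∈ t → 1 ≤ x × x ≤ n → x < M ⊎ (suc M ≤ x × x ≤ n)
  classify {x} x∈ (_ , x≤n) with <-cmp x M
  ... | tri< x<M _ _ = inj₁ x<M
  ... | tri≈ _ x≡M _ = ⊥-elim (Unique[x∷xs]⇒x∉xs uσ (subst (_∈ t) (trans x≡M (sym h≡M)) x∈))
  ... | tri> _ _ M<x = inj₂ (M<x , x≤n)
  complete : ∀ u → suc M ≤ u → u ≤ n → u ∈ t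
  complete u M<u u≤n with IsPerm-∈⁺ p (≤-trans (s≤s z≤n) M<u) u≤n
  ... | here u≡h = ⊥-elim (<-irrefl (sym (trans u≡h h≡M)) M<u)
  ... | there u∈t = u∈t
  headSmall : ∀ y r → t ≡ y ∷ r → y < M
  headSmall y r e with y <? M
  ... | yes y<M = y<M
  ... | no y≮M = ⊥-elim (notAdjacent [] h y r (cong (h ∷_) e) (≤-reflexive (sym h≡M)) (≮⇒≥ y≮M))

C1Condition⇒C1Shape : ∀ n σ → IsPerm n σ → C1Condition n σ → C1Shape n σ
C1Condition⇒C1Shape n [] p ((ρ , e) , _) = ⊥-elim (∷ʳ≢[] ρ n (sym e))
C1Condition⇒C1Shape n (h ∷ t) p c with C1Condition⇒Parsable n h t p c
... | M , refl , ps with Parsable⇒interleave (length t) t (suc M) ≤-refl ps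
...   | ss , t≡ , nes , als = p , M , ss , cong (M ∷_) t≡ , nes , als

-- Enumerating permutations and compositions

inserts : ℕ → List ℕ → List (List ℕ)
inserts x [] = (x ∷ []) ∷ []
inserts x (y ∷ ys) = (x ∷ y ∷ ys) ∷ map (y ∷_) (inserts x ys)

perms : ℕ → List (List ℕ)
perms zero = [] ∷ []
perms (suc m) = concatMap (inserts (suc m)) (perms m)

length-inserts : ∀ x l → length (inserts x l) ≡ suc (length l)
length-inserts x [] = refl
length-inserts x (y ∷ ys) = cong suc (trans (length-map (y ∷_) (inserts x ys)) (length-inserts x ys))

inserts-↭ : ∀ x l t → t ∈ inserts x l → t ↭ x ∷ l
inserts-↭ x [] t (here refl) = ↭-refl
inserts-↭ x (y ∷ ys) t (here refl) = ↭-refl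
inserts-↭ x (y ∷ ys) t (there m) with ∈-map⁻ (y ∷_) m
... | t′ , t′∈ , refl = ↭-trans (prep y (inserts-↭ x ys t′ t′∈)) (swap y x ↭-refl)

∈-inserts : ∀ x pre post → pre ++ x ∷ post ∈ inserts x (pre ++ post)
∈-inserts x [] [] = here refl
∈-inserts x [] (y ∷ post) = here refl
∈-inserts x (p ∷ pre) post = there (∈-map⁺ (p ∷_) (∈-inserts x pre post))

remove : ℕ → List ℕ → List ℕ
remove x [] = []
remove x (y ∷ ys) with x ≟ y
... | yes _ = ys
... | no _ = y ∷ remove x ys

remove-inserts : ∀ x l t → x ∉ l → t ∈ inserts x l → remove x t ≡ l
remove-inserts x [] t _ (here refl) with x ≟ x
... | yes _ = refl
... | no x≢x = ⊥-elim (x≢x refl)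
remove-inserts x (y ∷ ys) t _ (here refl) with x ≟ x
... | yes _ = refl
... | no x≢x = ⊥-elim (x≢x refl)
remove-inserts x (y ∷ ys) t x∉ (there m) with ∈-map⁻ (y ∷_) m
... | t′ , t′∈ , refl with x ≟ y
...   | yes x≡y = ⊥-elim (x∉ (here x≡y))
...   | no _ = cong (y ∷_) (remove-inserts x ys t′ (λ m′ → x∉ (there m′)) t′∈)

inserts-unique : ∀ x l → x ∉ l → Unique (inserts x l)
inserts-unique x [] _ = [] ∷ []
inserts-unique x (y ∷ ys) x∉ =
  All.tabulate (λ t∈ e → let (_ , _ , t≡) = ∈-map⁻ (y ∷_) t∈ in x∉ (here (∷-injectiveˡ (trans e t≡))))
  ∷ Unique-map (y ∷_) (inserts x ys) (inserts-unique x ys (λ m → x∉ (there m))) (λ a b _ _ e → ∷-injectiveʳ e)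

oneTo-suc-↭ : ∀ m → oneTo (suc m) ↭ suc m ∷ oneTo m
oneTo-suc-↭ m = ↭-trans (↭-reflexive (oneTo-∷ʳ m)) (↭-sym (∷↭∷ʳ (suc m) (oneTo m)))

perms-sound : ∀ m t → t ∈ perms m → t ↭ oneTo m
perms-sound zero t (here refl) = ↭-refl
perms-sound (suc m) t t∈ with ∈-concatMap⁻′ (inserts (suc m)) (perms m) t∈
... | l , l∈ , t∈′ = ↭-trans (inserts-↭ (suc m) l t t∈′) (↭-trans (prep (suc m) (perms-sound m l l∈)) (↭-sym (oneTo-suc-↭ m)))

perms-complete : ∀ m t → t ↭ oneTo m → t ∈ perms m
perms-complete zero t p rewrite ↭-empty-inv p = here refl
perms-complete (suc m) t p with ∈-∃++ (∈-resp-↭ (↭-sym (↭-trans p (oneTo-suc-↭ m))) (here refl))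
... | pre , post , refl = ∈-concatMap⁺′ (inserts (suc m)) (perms-complete m (pre ++ post) rest↭) (∈-inserts (suc m) pre post)
  where
  rest↭ : pre ++ post ↭ oneTo m
  rest↭ = drop-∷ (↭-trans (↭-sym (shift (suc m) pre post)) (↭-trans p (oneTo-suc-↭ m)))

perms-unique : ∀ m → Unique (perms m)
perms-unique zero = [] ∷ []
perms-unique (suc m) = Unique-concatMap (inserts (suc m)) (perms m) (perms-unique m)
  (λ l l∈ → inserts-unique (suc m) l (new l l∈))
  (λ a b t a∈ b∈ ta tb → trans (sym (remove-inserts (suc m) a t (new a a∈) ta)) (remove-inserts (suc m) b t (new b b∈) tb))
  where
  new : ∀ l → l ∈ perms m → suc m ∉ l
  new l l∈ m∈ = <-irrefl refl (proj₂ (∈-oneTo⁻ (∈-resp-↭ (perms-sound m l l∈) m∈)))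

length-perms : ∀ m → length (perms m) ≡ m !
length-perms zero = refl
length-perms (suc m) = begin
  length (perms (suc m))   ≡⟨ length-concatMap-const (inserts (suc m)) (perms m) (suc m) length-inserts-perm ⟩
  length (perms m) * suc m ≡⟨ cong (_* suc m) (length-perms m) ⟩
  m ! * suc m              ≡⟨ *-comm (m !) (suc m) ⟩
  suc m !                  ∎
  where
  length-inserts-perm : ∀ l → l ∈ perms m → length (inserts (suc m) l) ≡ suc m
  length-inserts-perm l l∈ =
    trans (length-inserts (suc m) l) (cong suc (trans (↭-length (perms-sound m l l∈)) (length-oneTo m)))

consHead : ℕ → List (List ℕ) → List (List ℕ)
consHead x [] = (x ∷ []) ∷ []
consHead x (a ∷ ss) = (x ∷ a) ∷ ss

splits : ℕ → List ℕ → List (List (List ℕ))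
splits zero [] = [] ∷ []
splits zero (_ ∷ _) = []
splits (suc s) [] = []
splits (suc s) (x ∷ xs) = map ((x ∷ []) ∷_) (splits s xs) ++ map (consHead x) (splits (suc s) xs)

IsSplit : ℕ → List ℕ → List (List ℕ) → Set
IsSplit s τ ss = concat ss ≡ τ × All NonEmpty ss × length ss ≡ s

IsSplit-consHead : ∀ x {s τ} ss → IsSplit (suc s) τ ss → IsSplit (suc s) (x ∷ τ) (consHead x ss)
IsSplit-consHead x (a ∷ ss) (c , _ ∷ ne , l) = cong (x ∷_) c , tt ∷ ne , l

splits-sound : ∀ s τ ss → ss ∈ splits s τ → IsSplit s τ ss
splits-sound zero [] ss (here refl) = refl , [] , refl
splits-sound (suc s) (x ∷ xs) ss m with ∈-++⁻ (map ((x ∷ []) ∷_) (splits s xs)) m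
... | inj₁ m₁ with ∈-map⁻ ((x ∷ []) ∷_) m₁
...   | ss′ , m′ , refl with splits-sound s xs ss′ m′
...     | c , ne , l = cong (x ∷_) c , tt ∷ ne , cong suc l
splits-sound (suc s) (x ∷ xs) ss m | inj₂ m₂ with ∈-map⁻ (consHead x) m₂
... | ss′ , m′ , refl = IsSplit-consHead x ss′ (splits-sound (suc s) xs ss′ m′)

splits-complete : ∀ τ s ss → IsSplit s τ ss → ss ∈ splits s τ
splits-complete [] zero [] _ = here refl
splits-complete [] s ((_ ∷ _) ∷ ss) (() , _)
splits-complete (x ∷ τ) (suc s) ((y ∷ []) ∷ ss) (c , _ ∷ ne , l) with ∷-injective c
... | refl , c′ = ∈-++⁺ˡ (∈-map⁺ ((x ∷ []) ∷_) (splits-complete τ s ss (c′ , ne , suc-injective l)))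
splits-complete (x ∷ τ) (suc s) ((y ∷ z ∷ a) ∷ ss) (c , _ ∷ ne , l) with ∷-injective c
... | refl , c′ = ∈-++⁺ʳ (map ((x ∷ []) ∷_) (splits s τ))
                    (∈-map⁺ (consHead x) (splits-complete τ (suc s) ((z ∷ a) ∷ ss) (c′ , tt ∷ ne , l)))
splits-complete _ _ ([] ∷ ss) (_ , () ∷ _ , _)
splits-complete (x ∷ τ) zero [] (() , _)
splits-complete _ zero ((y ∷ a) ∷ ss) (_ , _ , ())

splits-unique : ∀ s τ → Unique (splits s τ)
splits-unique zero [] = [] ∷ []
splits-unique zero (_ ∷ _) = []
splits-unique (suc s) [] = []
splits-unique (suc s) (x ∷ xs) =
  Unique.++⁺ (Unique-map ((x ∷ []) ∷_) (splits s xs) (splits-unique s xs) (λ _ _ _ _ e → ∷-injectiveʳ e))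
             (Unique-map (consHead x) (splits (suc s) xs) (splits-unique (suc s) xs) consHead-injective)
             (λ (m₁ , m₂) → disjoint m₁ m₂)
  where
  splits-shape : ∀ ss → ss ∈ splits (suc s) xs → ∃₂ λ y b → ∃ λ r → ss ≡ (y ∷ b) ∷ r
  splits-shape ss m with splits-sound (suc s) xs ss m
  splits-shape ((y ∷ b) ∷ r) m | _ , tt ∷ _ , _ = y , b , r , refl
  consHead-injective : ∀ a b → a ∈ splits (suc s) xs → b ∈ splits (suc s) xs → consHead x a ≡ consHead x b → a ≡ b
  consHead-injective a b a∈ b∈ e with splits-shape a a∈ | splits-shape b b∈
  ... | _ , _ , r , refl | _ , _ , _ , refl with ∷-injective e
  ...   | e₁ , refl = cong (_∷ r) (∷-injectiveʳ e₁)
  disjoint : ∀ {t} → t ∈ map ((x ∷ []) ∷_) (splits s xs) → t ∈ map (consHead x) (splits (suc s) xs) → ⊥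
  disjoint m₁ m₂ with ∈-map⁻ ((x ∷ []) ∷_) m₁ | ∈-map⁻ (consHead x) m₂
  ... | _ , _ , refl | b , b∈ , e with splits-shape b b∈
  ...   | _ , _ , _ , refl with ∷-injectiveˡ e
  ...     | ()

length-splits : ∀ s x xs → length (splits (suc s) (x ∷ xs)) ≡ length xs C s
length-splits s x xs = begin
  length (map ((x ∷ []) ∷_) (splits s xs) ++ map (consHead x) (splits (suc s) xs))
    ≡⟨ length-++ (map ((x ∷ []) ∷_) (splits s xs)) ⟩
  length (map ((x ∷ []) ∷_) (splits s xs)) + length (map (consHead x) (splits (suc s) xs))
    ≡⟨ cong₂ _+_ (length-map _ (splits s xs)) (length-map _ (splits (suc s) xs)) ⟩
  length (splits s xs) + length (splits (suc s) xs)
    ≡⟨ pascal s xs ⟩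
  length xs C s ∎
  where
  pascal : ∀ s xs → length (splits s xs) + length (splits (suc s) xs) ≡ length xs C s
  pascal zero [] = refl
  pascal (suc s) [] = refl
  pascal zero (y ∷ ys) = length-splits zero y ys
  pascal (suc s) (y ∷ ys) = trans (cong₂ _+_ (length-splits s y ys) (length-splits (suc s) y ys))
                                  (nCk+nC[k+1]≡[n+1]C[k+1] (length ys) s)

length≤length-concat : ∀ (ss : List (List A)) → All NonEmpty ss → length ss ≤ length (concat ss)
length≤length-concat [] _ = z≤n
length≤length-concat ((x ∷ a) ∷ ss) (_ ∷ ne) =
  s≤s (≤-trans (length≤length-concat ss ne) (≤-trans (m≤n+m _ (length a)) (≤-reflexive (sym (length-++ a)))))

range : ℕ → ℕ → List ℕ
range Q zero = []
range Q (suc k) = Q ∷ range (suc Q) k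

range-++ : ∀ Q a b → range Q (a + b) ≡ range Q a ++ range (Q + a) b
range-++ Q zero b = cong (λ z → range z b) (sym (+-identityʳ Q))
range-++ Q (suc a) b = cong (Q ∷_) (trans (range-++ (suc Q) a b) (cong (λ z → range (suc Q) a ++ range z b) (sym (+-suc Q a))))

map-suc-applyUpTo : ∀ (f : ℕ → ℕ) Q n → (∀ i → f i ≡ Q + i) → map suc (applyUpTo f n) ≡ range (suc Q) n
map-suc-applyUpTo f Q zero h = refl
map-suc-applyUpTo f Q (suc n) h = cong₂ _∷_ (cong suc (trans (h 0) (+-identityʳ Q)))
  (map-suc-applyUpTo (λ i → f (suc i)) (suc Q) n (λ i → trans (h (suc i)) (+-suc Q i)))

oneTo-+ : ∀ m j → oneTo (m + j) ≡ oneTo m ++ range (suc m) j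
oneTo-+ m j = begin
  oneTo (m + j)                    ≡⟨ oneTo≡range (m + j) ⟩
  range 1 (m + j)                  ≡⟨ range-++ 1 m j ⟩
  range 1 m ++ range (suc m) j     ≡⟨ cong (_++ range (suc m) j) (oneTo≡range m) ⟨
  oneTo m ++ range (suc m) j       ∎
  where
  oneTo≡range : ∀ n → oneTo n ≡ range 1 n
  oneTo≡range n = map-suc-applyUpTo id 0 n (λ _ → refl)

interleave-↭ : ∀ Q ss → interleave Q ss ↭ concat ss ++ range Q (length ss)
interleave-↭ Q [] = ↭-refl
interleave-↭ Q (a ∷ ss) = ↭-trans (++⁺ˡ a (prep Q (interleave-↭ (suc Q) ss)))
  (↭-trans (++⁺ˡ a (↭-sym (shift Q (concat ss) (range (suc Q) (length ss)))))
    (↭-reflexive (sym (++-assoc a (concat ss) _))))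

assemble : ℕ → List (List ℕ) → List ℕ
assemble M ss = M ∷ interleave (suc M) ss

assemble-↭ : ∀ M ss → assemble M ss ↭ concat ss ++ range M (suc (length ss))
assemble-↭ M ss = ↭-trans (prep M (interleave-↭ (suc M) ss)) (↭-sym (shift M (concat ss) _))

++-∷-below-injective : ∀ (Q : ℕ) a₁ a₂ t₁ t₂ → All (_< Q) a₁ → All (_< Q) a₂ →
  a₁ ++ Q ∷ t₁ ≡ a₂ ++ Q ∷ t₂ → a₁ ≡ a₂ × t₁ ≡ t₂
++-∷-below-injective Q [] [] t₁ t₂ _ _ e = refl , ∷-injectiveʳ e
++-∷-below-injective Q [] (y ∷ a₂) t₁ t₂ _ (y<Q ∷ _) e = ⊥-elim (<-irrefl (sym (∷-injectiveˡ e)) y<Q)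
++-∷-below-injective Q (y ∷ a₁) [] t₁ t₂ (y<Q ∷ _) _ e = ⊥-elim (<-irrefl (∷-injectiveˡ e) y<Q)
++-∷-below-injective Q (y ∷ a₁) (_ ∷ a₂) t₁ t₂ (_ ∷ p₁) (_ ∷ p₂) e with ∷-injective e
... | refl , e′ with ++-∷-below-injective Q a₁ a₂ t₁ t₂ p₁ p₂ e′
...   | refl , e″ = refl , e″

interleave-injective : ∀ L Q ss₁ ss₂ → L ≤ Q → All (All (_< L)) ss₁ → All (All (_< L)) ss₂ →
  interleave Q ss₁ ≡ interleave Q ss₂ → ss₁ ≡ ss₂
interleave-injective L Q [] [] _ _ _ _ = refl
interleave-injective L Q [] (a ∷ ss₂) _ _ _ e = ⊥-elim (++-∷≢[] a Q _ (sym e))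
interleave-injective L Q (a ∷ ss₁) [] _ _ _ e = ⊥-elim (++-∷≢[] a Q _ e)
interleave-injective L Q (a₁ ∷ ss₁) (a₂ ∷ ss₂) L≤Q (p₁ ∷ q₁) (p₂ ∷ q₂) e
  with ++-∷-below-injective Q a₁ a₂ _ _ (All.map (λ z → <-≤-trans z L≤Q) p₁) (All.map (λ z → <-≤-trans z L≤Q) p₂) e
... | refl , e′ = cong (a₁ ∷_) (interleave-injective L (suc Q) ss₁ ss₂ (m≤n⇒m≤1+n L≤Q) q₁ q₂ e′)

c1Ks : ℕ → List ℕ
c1Ks n = applyUpTo (λ i → i + 2) (⌈ n /2⌉ ∸ 1)

c1PermsOf : ℕ → ℕ → List (List ℕ)
c1PermsOf m j = concatMap (λ τ → map (assemble (suc m)) (splits j τ)) (perms m)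

c1Perms : ℕ → List (List ℕ)
c1Perms n = concatMap (λ K → c1PermsOf (n ∸ K) (K ∸ 1)) (c1Ks n)

∈-c1Ks⁻ : ∀ n K → 3 ≤ n → K ∈ c1Ks n → ∃ λ s → K ≡ suc (suc s) × K < n
∈-c1Ks⁻ (suc (suc n)) K _ K∈ with ∈-applyUpTo⁻ (λ i → i + 2) K∈
... | s , s< , refl = s , +-comm s 2 , <-≤-trans (s≤s (+2≤ s<)) (⌈n/2⌉<n n)
  where
  +2≤ : ∀ {c} → s < c ∸ 1 → s + 2 ≤ c
  +2≤ {suc c} s< = subst (_≤ suc c) (+-comm 2 s) (s≤s s<)

∈-c1Ks⁺ : ∀ n s → suc (suc s) ≤ ⌈ n /2⌉ → suc (suc s) ∈ c1Ks n
∈-c1Ks⁺ n s K≤ = subst (_∈ c1Ks n) (+-comm s 2) (∈-applyUpTo⁺ (λ i → i + 2) (∸-monoˡ-≤ 1 K≤))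

∈-c1PermsOf⁻ : ∀ m j t → t ∈ c1PermsOf m j → ∃₂ λ τ ss → τ ∈ perms m × IsSplit j τ ss × t ≡ assemble (suc m) ss
∈-c1PermsOf⁻ m j t t∈ with ∈-concatMap⁻′ (λ τ → map (assemble (suc m)) (splits j τ)) (perms m) t∈
... | τ , τ∈ , t∈′ with ∈-map⁻ (assemble (suc m)) t∈′
...   | ss , ss∈ , e = τ , ss , τ∈ , splits-sound j τ ss ss∈ , e

∈-c1PermsOf⁺ : ∀ m j ss → concat ss ∈ perms m → IsSplit j (concat ss) ss → assemble (suc m) ss ∈ c1PermsOf m j
∈-c1PermsOf⁺ m j ss τ∈ split =
  ∈-concatMap⁺′ (λ τ → map (assemble (suc m)) (splits j τ)) τ∈ (∈-map⁺ (assemble (suc m)) (splits-complete _ j ss split))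

concat-perms-below : ∀ m τ ss → τ ∈ perms m → concat ss ≡ τ → All (All (_< suc m)) ss
concat-perms-below m τ ss τ∈ refl = All.concat⁻ (All.tabulate λ x∈ → s≤s (proj₂ (∈-oneTo⁻ (∈-resp-↭ (perms-sound m τ τ∈) x∈))))

length-c1PermsOf : ∀ m s → length (c1PermsOf (suc m) (suc s)) ≡ suc m ! * (m C s)
length-c1PermsOf m s = begin
  length (c1PermsOf (suc m) (suc s)) ≡⟨ length-concatMap-const _ (perms (suc m)) (m C s) length-splits-perm ⟩
  length (perms (suc m)) * (m C s)  ≡⟨ cong (_* (m C s)) (length-perms (suc m)) ⟩
  suc m ! * (m C s)                 ∎
  where
  length-splits-perm : ∀ τ → τ ∈ perms (suc m) → length (map (assemble (suc (suc m))) (splits (suc s) τ)) ≡ m C s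
  length-splits-perm τ τ∈ with τ | trans (↭-length (perms-sound (suc m) τ τ∈)) (length-oneTo (suc m))
  ... | x ∷ xs | e = trans (length-map _ (splits (suc s) (x ∷ xs))) (trans (length-splits s x xs) (cong (_C s) (suc-injective e)))

length-c1Perms : ∀ n → 3 ≤ n → length (c1Perms n) ≡ countFormula n
length-c1Perms n n≥3 = trans (length-concatMap _ (c1Ks n)) (cong sum (map-cong-local (All.tabulate length-summand)))
  where
  length-summand : ∀ {K} → K ∈ c1Ks n → length (c1PermsOf (n ∸ K) (K ∸ 1)) ≡ (n ∸ K) ! * ((n ∸ K ∸ 1) C (K ∸ 2))
  length-summand {K} K∈ with ∈-c1Ks⁻ n K n≥3 K∈
  ... | s , refl , K<n with n ∸ K | m<n⇒0<n∸m K<n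
  ...   | suc m | _ = length-c1PermsOf m s

c1PermsOf-unique : ∀ m j → Unique (c1PermsOf m j)
c1PermsOf-unique m j = Unique-concatMap _ (perms m) (perms-unique m)
    (λ τ τ∈ → Unique-map (assemble (suc m)) (splits j τ) (splits-unique j τ) (λ a b a∈ b∈ → injective τ∈ τ∈ a∈ b∈))
    disjoint
  where
  injective : ∀ {τ₁ τ₂ a b} → τ₁ ∈ perms m → τ₂ ∈ perms m → a ∈ splits j τ₁ → b ∈ splits j τ₂ →
    assemble (suc m) a ≡ assemble (suc m) b → a ≡ b
  injective {τ₁} {τ₂} {a} {b} τ₁∈ τ₂∈ a∈ b∈ e = interleave-injective (suc m) (suc (suc m)) a b (n≤1+n _)
    (concat-perms-below m τ₁ a τ₁∈ (proj₁ (splits-sound j τ₁ a a∈)))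
    (concat-perms-below m τ₂ b τ₂∈ (proj₁ (splits-sound j τ₂ b b∈))) (∷-injectiveʳ e)
  disjoint : ∀ τ₁ τ₂ t → τ₁ ∈ perms m → τ₂ ∈ perms m → t ∈ map (assemble (suc m)) (splits j τ₁) →
    t ∈ map (assemble (suc m)) (splits j τ₂) → τ₁ ≡ τ₂
  disjoint τ₁ τ₂ t τ₁∈ τ₂∈ t₁ t₂ with ∈-map⁻ (assemble (suc m)) t₁ | ∈-map⁻ (assemble (suc m)) t₂
  ... | a , a∈ , e₁ | b , b∈ , e₂ with injective τ₁∈ τ₂∈ a∈ b∈ (trans (sym e₁) e₂)
  ...   | refl = trans (sym (proj₁ (splits-sound j τ₁ a a∈))) (proj₁ (splits-sound j τ₂ a b∈))

c1Perms-unique : ∀ n → 3 ≤ n → Unique (c1Perms n)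
c1Perms-unique n n≥3 = Unique-concatMap _ (c1Ks n) Ks-unique (λ K _ → c1PermsOf-unique (n ∸ K) (K ∸ 1)) disjoint
  where
  Ks-unique : Unique (c1Ks n)
  Ks-unique = Unique.applyUpTo⁺₁ (λ i → i + 2) _ (λ {i} {j} i<j _ e → <-irrefl (+-cancelʳ-≡ 2 i j e) i<j)
  head≡ : ∀ K t → t ∈ c1PermsOf (n ∸ K) (K ∸ 1) → ∃ λ r → t ≡ suc (n ∸ K) ∷ r
  head≡ K t t∈ with ∈-c1PermsOf⁻ (n ∸ K) (K ∸ 1) t t∈
  ... | _ , ss , _ , _ , e = _ , e
  disjoint : ∀ K₁ K₂ t → K₁ ∈ c1Ks n → K₂ ∈ c1Ks n → t ∈ c1PermsOf (n ∸ K₁) (K₁ ∸ 1) → t ∈ c1PermsOf (n ∸ K₂) (K₂ ∸ 1) → K₁ ≡ K₂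
  disjoint K₁ K₂ t K₁∈ K₂∈ t₁ t₂ with head≡ K₁ t t₁ | head≡ K₂ t t₂ | ∈-c1Ks⁻ n K₁ n≥3 K₁∈ | ∈-c1Ks⁻ n K₂ n≥3 K₂∈
  ... | _ , e₁ | _ , e₂ | _ , _ , K₁<n | _ , _ , K₂<n =
    ∸-cancelˡ-≡ (<⇒≤ K₁<n) (<⇒≤ K₂<n) (suc-injective (∷-injectiveˡ (trans (sym e₁) e₂)))

∈-c1Perms⇒C1Shape : ∀ n σ → 3 ≤ n → σ ∈ c1Perms n → C1Shape n σ
∈-c1Perms⇒C1Shape n σ n≥3 σ∈ with ∈-concatMap⁻′ _ (c1Ks n) σ∈
... | K , K∈ , σ∈K with ∈-c1Ks⁻ n K n≥3 K∈
... | s , refl , K<n with ∈-c1PermsOf⁻ (n ∸ K) (suc s) σ σ∈K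
...   | τ , ss , τ∈ , (refl , nes , |ss|≡) , refl = σ↭ , suc m , ss , refl , nes , concat-perms-below m _ ss τ∈ refl
  where
  m = n ∸ K
  σ↭ : assemble (suc m) ss ↭ oneTo n
  σ↭ = ↭-trans (assemble-↭ (suc m) ss) (↭-trans (++⁺ʳ _ (perms-sound m _ τ∈))
         (↭-reflexive (trans (cong (λ j → oneTo m ++ range (suc m) (suc j)) |ss|≡)
                             (trans (sym (oneTo-+ m K)) (cong oneTo (m∸n+n≡m (<⇒≤ K<n)))))))

C1Shape⇒∈-c1Perms : ∀ n σ → 3 ≤ n → C1Shape n σ → σ ∈ c1Perms n
C1Shape⇒∈-c1Perms n σ n≥3 (p , M , [] , refl , nes , als) =
  ⊥-elim (<-irrefl (trans (↭-length p) (length-oneTo n)) (≤-trans (s≤s (s≤s z≤n)) n≥3))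
C1Shape⇒∈-c1Perms n σ n≥3 (p , zero , a ∷ ss′ , refl , nes , als) with IsPerm-∈⁻ p (here refl)
... | () , _
C1Shape⇒∈-c1Perms n σ n≥3 (p , suc m , ss@(a ∷ ss′) , refl , nes , als) =
  ∈-concatMap⁺′ _ (∈-c1Ks⁺ n s K≤⌈n/2⌉) (subst (λ m′ → σ ∈ c1PermsOf m′ (suc s)) (sym n∸K≡m) σ∈)
  where
  s = length ss′
  top : suc m + suc s ≡ n
  top = interleave-top n (suc m) ss (≤-trans (s≤s z≤n) n≥3) p als
  n∸K≡m : n ∸ suc (suc s) ≡ m
  n∸K≡m = trans (cong (_∸ suc (suc s)) (sym top)) (m+n∸n≡m m (suc s))
  blocks↭ : concat ss ↭ oneTo m
  blocks↭ = ↭-++-cancelʳ (range (suc m) (suc (length ss))) (concat ss) (oneTo m)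
    (↭-trans (↭-sym (assemble-↭ (suc m) ss))
      (↭-trans p (↭-reflexive (trans (cong oneTo (trans (sym top) (sym (+-suc m (suc s))))) (oneTo-+ m (suc (length ss)))))))
  σ∈ : σ ∈ c1PermsOf m (suc s)
  σ∈ = ∈-c1PermsOf⁺ m (suc s) ss (perms-complete m (concat ss) blocks↭) (refl , nes , refl)
  s<m : suc s ≤ m
  s<m = ≤-trans (length≤length-concat ss nes) (≤-reflexive (trans (↭-length blocks↭) (length-oneTo m)))
  -- n = m + 1 + (s + 1) ≥ 2 (s + 2) - 1, i.e. K ≤ ⌈ n / 2 ⌉ for K = s + 2.
  K≤⌈n/2⌉ : suc (suc s) ≤ ⌈ n /2⌉
  K≤⌈n/2⌉ = ≤-trans (≤-reflexive (n≡⌊n+n/2⌋ (suc (suc s))))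
              (⌊n/2⌋-mono (≤-trans (≤-reflexive (cong suc (+-suc (suc s) (suc s))))
                            (s≤s (≤-trans (+-monoˡ-≤ (suc s) (s≤s s<m)) (≤-reflexive top)))))

uniquePreimage⇔C1Shape : ∀ n σ → 1 ≤ n → HasUniquePreimage n σ ⇔ C1Shape n σ
uniquePreimage⇔C1Shape n σ n≥1 = mk⇔ (uniquePreimage⇒C1Shape n σ n≥1) (C1Shape⇒uniquePreimage n σ)

C1Shape⇔C1Condition : ∀ n σ → 1 ≤ n → C1Shape n σ ⇔ (IsPerm n σ × C1Condition n σ)
C1Shape⇔C1Condition n σ n≥1 =
  mk⇔ (λ shape → proj₁ shape , C1Shape⇒C1Condition n σ n≥1 shape) (λ (perm , c) → C1Condition⇒C1Shape n σ perm c)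

∈-c1Perms⇔C1Shape : ∀ n σ → 3 ≤ n → σ ∈ c1Perms n ⇔ C1Shape n σ
∈-c1Perms⇔C1Shape n σ n≥3 = mk⇔ (∈-c1Perms⇒C1Shape n σ n≥3) (C1Shape⇒∈-c1Perms n σ n≥3)

mainTheorem5 : (n : ℕ) → 3 ≤ n →
    (∀ (σ : List ℕ) → HasUniquePreimage n σ ⇔ (IsPerm n σ × C1Condition n σ)) ×
    (∃[ L ] (Unique L × (∀ (σ : List ℕ) → σ ∈ L ⇔ HasUniquePreimage n σ) ×
    length L ≡ countFormula n))
mainTheorem5 n n≥3 =
  (λ σ → ⇔-trans (uniquePreimage⇔C1Shape n σ n≥1) (C1Shape⇔C1Condition n σ n≥1)) ,
  c1Perms n , c1Perms-unique n n≥3 ,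
  (λ σ → ⇔-trans (∈-c1Perms⇔C1Shape n σ n≥3) (⇔-sym (uniquePreimage⇔C1Shape n σ n≥1))) ,
  length-c1Perms n n≥3
  where
  n≥1 : 1 ≤ n
  n≥1 = ≤-trans (s≤s z≤n) n≥3
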